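{- For every $n\ge1$, the noncrossing arc diagrams on $n$ points that are matchings are in bijection with the permutations of $\{1,\ldots,n\}$ avoiding the consecutive pattern $321$, i.e. permutations $x$ having no $i$ with $x_i>x_{i+1}>x_{i+2}$.
   Context: Place points $1,\ldots,n$ bottom to top on a vertical line. An arc joins a point $p$ to a strictly higher point $q$, moving monotonically upward and passing left or right of each intermediate point; arcs are considered up to combinatorial equivalence (endpoints and the set of intermediate points on the left). A noncrossing arc diagram is a collection of arcs such that no two intersect except possibly at endpoints and no two share the same upper endpoint or the same lower endpoint, considered up to combinatorial equivalence. A noncrossing arc diagram is a matching if its arcs are pairwise disjoint, including at their endpoints. -}

module Defs where

open import Data.Nat using (ℕ; suc)
open import Data.Fin using (Fin; toℕ; _<_)
open import Data.Bool using (Bool; true; false)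
open import Data.Vec using (Vec; lookup)
open import Data.List using (List)
open import Data.List.Relation.Unary.AllPairs using (AllPairs)
open import Data.Product using (_×_; ∃; ∃₂; _,_)
open import Data.Sum using (_⊎_)
open import Data.Empty using (⊥)
open import Relation.Nullary using (¬_)
open import Relation.Binary.PropositionalEquality using (_≡_; _≢_)
open import Data.Refinement using (Refinement; value)

-- Points 1,…,n (bottom to top) are represented by Fin n (0,…,n-1).

-- Raw arc data: lower endpoint p, upper endpoint q, and a vector
-- `left` with  lookup left k ≡ true  iff k is an intermediate point
-- belonging to the set L of intermediate points "on the left"
-- (the arc passes to the left of k); intermediate points with
-- `false` are passed on the right.  Entries outside the open interval
-- (p,q) are required to be false, so that each combinatorial
-- equivalence class has exactly one representative.

RawArc : ℕ → Set
RawArc n = Fin n × Fin n × Vec Bool n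

WellFormedArc : ∀ {n} → RawArc n → Set
WellFormedArc (p , q , left) =
  p < q × (∀ k → lookup left k ≡ true → (p < k × k < q))

Arc : ℕ → Set
Arc n = Refinement (RawArc n) WellFormedArc

lo : ∀ {n} → Arc n → Fin n
lo a with value a
... | (p , _ , _) = p

hi : ∀ {n} → Arc n → Fin n
hi a with value a
... | (_ , q , _) = q

sides : ∀ {n} → Arc n → Vec Bool n
sides a with value a
... | (_ , _ , s) = s

PassesLeftOf : ∀ {n} → Arc n → Fin n → Set
PassesLeftOf a k = lo a < k × k < hi a × lookup (sides a) k ≡ true

PassesRightOf : ∀ {n} → Arc n → Fin n → Set
PassesRightOf a k = lo a < k × k < hi a × lookup (sides a) k ≡ false

EndsAt : ∀ {n} → Arc n → Fin n → Set
EndsAt a k = k ≡ lo a ⊎ k ≡ hi a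

StrictlyLeftAt : ∀ {n} → Arc n → Arc n → Fin n → Set
StrictlyLeftAt a b k =
    (PassesLeftOf a k × EndsAt b k)
  ⊎ (PassesLeftOf a k × PassesRightOf b k)
  ⊎ (EndsAt a k × PassesRightOf b k)

-- Two (monotone) arcs must intersect away from common endpoints
-- exactly when their left/right order is reversed somewhere on the
-- common height range.
Cross : ∀ {n} → Arc n → Arc n → Set
Cross a b = ∃₂ λ k k′ → StrictlyLeftAt a b k × StrictlyLeftAt b a k′

-- A collection (finite set) of arcs is represented by the list of its
-- arcs ordered by strictly increasing lower endpoint.  Since distinct
-- arcs of a diagram never share a lower endpoint, this is a canonical
-- (one-to-one) encoding of the set of arcs; the strict increase of the
-- lower endpoints is exactly the condition "no two share the same
-- lower endpoint".

NoncrossingPair : ∀ {n} → Arc n → Arc n → Set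
NoncrossingPair a b = ¬ Cross a b × lo a < lo b × hi a ≢ hi b

IsNoncrossingArcDiagram : ∀ {n} → List (Arc n) → Set
IsNoncrossingArcDiagram = AllPairs NoncrossingPair

DisjointEndpoints : ∀ {n} → Arc n → Arc n → Set
DisjointEndpoints a b =
  lo a ≢ lo b × hi a ≢ hi b × lo a ≢ hi b × hi a ≢ lo b

IsMatching : ∀ {n} → List (Arc n) → Set
IsMatching as = IsNoncrossingArcDiagram as × AllPairs DisjointEndpoints as

NoncrossingMatching : ℕ → Set
NoncrossingMatching n = Refinement (List (Arc n)) IsMatching

IsPermutation : ∀ {n} → Vec (Fin n) n → Set
IsPermutation {n} x = ∀ i j → lookup x i ≡ lookup x j → i ≡ j

Avoids321 : ∀ {n} → Vec (Fin n) n → Set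
Avoids321 {n} x = ∀ (i j k : Fin n) →
  toℕ j ≡ suc (toℕ i) → toℕ k ≡ suc (toℕ j) →
  ¬ (lookup x j < lookup x i × lookup x k < lookup x j)

Consecutive321Avoiding : ℕ → Set
Consecutive321Avoiding n =
  Refinement (Vec (Fin n) n) (λ x → IsPermutation x × Avoids321 x)

module Submission where

-- Reading's map δ sends a word x to the diagram with one arc for each descent x_i > x_{i+1}, going
-- from x_{i+1} up to x_i and passing left of exactly those intermediate points that occur after
-- x_{i+1} in x. The arc of a later descent never lies strictly left of the arc of an earlier one,
-- so δ x is noncrossing, and two arcs share an endpoint only at two adjacent descents, i.e. at a
-- consecutive 321. Conversely, call v a candidate of a diagram if v is not the top of an arc,
-- every arc spanning v passes it on the left, and the arc starting at v has nothing on its left.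
-- The last letter of x is the largest candidate of δ x, so δ is injective by induction. For
-- surjectivity, the blocks of a matching (its arcs and its isolated points) are ordered by "lies
-- strictly left of somewhere"; in a noncrossing diagram a path through a lowest block can be
-- shortcut, so there is a rightmost block, and it is a candidate. Appending the largest candidate
-- to a word for the diagram with that point deleted gives a word for the matching.

open import Defs
open import Level using (Level)
open import Data.Nat as ℕ using (ℕ; zero; suc; _≤_; z≤n; s≤s)
import Data.Nat.Properties as ℕP
open import Data.Nat.Induction using (<-wellFounded)
open import Data.Fin as F using (Fin; toℕ)
import Data.Fin.Properties as FP
open import Data.Fin.Induction using (>-wellFounded)
open import Data.Bool using (Bool; true; false)
import Data.Bool.Properties as BoolP
open import Data.Maybe using (Maybe; just; nothing)
open import Data.Maybe.Properties using (just-injective)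
open import Data.List as L using (List; []; _∷_; _∷ʳ_; length; mapMaybe; allFin)
import Data.List.Properties as ListP
open import Data.List.Relation.Unary.Any as Any using (Any; here; there)
open import Data.List.Relation.Unary.All as All using (All; []; _∷_)
open import Data.List.Relation.Unary.AllPairs as AllPairs using (AllPairs; []; _∷_)
import Data.List.Relation.Unary.AllPairs.Properties as AllPairsP
open import Data.List.Relation.Unary.Unique.Propositional using (Unique)
import Data.List.Relation.Unary.Unique.Propositional.Properties as UniqueP
open import Data.List.Membership.Propositional using (_∈_; _∉_; find; lose)
open import Data.List.Membership.Propositional.Properties using (∈-allFin; ∈-++⁻; ∈-++⁺ˡ; ∈-++⁺ʳ)
open import Data.Vec as V using (Vec; lookup; tabulate; _[_]≔_)
import Data.Vec.Properties as VecP
open import Data.Product using (Σ; ∃; _×_; _,_; proj₁; proj₂)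
open import Data.Sum using (_⊎_; inj₁; inj₂; [_,_]′)
open import Data.Empty using (⊥)
open import Data.Refinement using (value; value-injective; proof)
open import Data.Irrelevant as Irrelevant using (Irrelevant; [_])
open import Function.Bundles using (_⤖_; mk⤖; mk⇔)
import Function.Properties.Bijection as BijectionP
open import Induction.WellFounded using (Acc; acc)
open import Relation.Unary using (Pred; Decidable)
open import Relation.Binary using (Rel; Irreflexive; Asymmetric; DecidableEquality)
open import Relation.Binary.Definitions using (tri<; tri≈; tri>) renaming (Decidable to Decidable₂)
open import Relation.Binary.PropositionalEquality
open import Relation.Nullary using (¬_; Dec; yes; no; does; ¬?; contradiction)
open import Relation.Nullary.Decidable using (recompute; dec-true; does-⇔; map′; _×-dec_; _⊎-dec_; _→-dec_)

private variable
  a b p r : Level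
  A : Set a
  B : Set b

module _ (f : A → Maybe B) where

  ∈-mapMaybe⁻ : ∀ xs {y} → y ∈ mapMaybe f xs → ∃ λ x → x ∈ xs × f x ≡ just y
  ∈-mapMaybe⁻ (x ∷ xs) y∈ with f x in fx
  ∈-mapMaybe⁻ (x ∷ xs) (here refl) | just _ = x , here refl , fx
  ∈-mapMaybe⁻ (x ∷ xs) (there y∈)  | just _ =
    let (x′ , x′∈ , fx′) = ∈-mapMaybe⁻ xs y∈ in x′ , there x′∈ , fx′
  ∈-mapMaybe⁻ (x ∷ xs) y∈          | nothing =
    let (x′ , x′∈ , fx′) = ∈-mapMaybe⁻ xs y∈ in x′ , there x′∈ , fx′

  ∈-mapMaybe⁺ : ∀ xs {x y} → x ∈ xs → f x ≡ just y → y ∈ mapMaybe f xs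
  ∈-mapMaybe⁺ (x ∷ xs) (here refl) fx≡y with f x
  ... | just _ = here (just-injective (sym fx≡y))
  ∈-mapMaybe⁺ (x ∷ xs) (there x∈) fx≡y with f x
  ... | just _  = there (∈-mapMaybe⁺ xs x∈ fx≡y)
  ... | nothing = ∈-mapMaybe⁺ xs x∈ fx≡y

  AllPairs-mapMaybe⁺ : ∀ {R : Rel A r} {S : Rel B r} {xs} →
    (∀ {x x′ y y′} → R x x′ → f x ≡ just y → f x′ ≡ just y′ → S y y′) →
    AllPairs R xs → AllPairs S (mapMaybe f xs)
  AllPairs-mapMaybe⁺ R⇒S []                      = []
  AllPairs-mapMaybe⁺ R⇒S (_∷_ {x} {xs} Rx Rxs) with f x in fx
  ... | just y  = All.tabulate (λ y′∈ → let (x′ , x′∈ , fx′) = ∈-mapMaybe⁻ xs y′∈ in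
                                        R⇒S (All.lookup Rx x′∈) fx fx′)
                  ∷ AllPairs-mapMaybe⁺ R⇒S Rxs
  ... | nothing = AllPairs-mapMaybe⁺ R⇒S Rxs

module _ {R : Rel A r} where

  AllPairs-∈ : ∀ {xs} → AllPairs R xs → ∀ {x y} → x ∈ xs → y ∈ xs → x ≡ y ⊎ R x y ⊎ R y x
  AllPairs-∈ (Rx ∷ _)   (here refl) (here refl) = inj₁ refl
  AllPairs-∈ (Rx ∷ _)   (here refl) (there y∈)  = inj₂ (inj₁ (All.lookup Rx y∈))
  AllPairs-∈ (Rx ∷ _)   (there x∈)  (here refl) = inj₂ (inj₂ (All.lookup Rx x∈))
  AllPairs-∈ (_ ∷ Rxs)  (there x∈)  (there y∈)  = AllPairs-∈ Rxs x∈ y∈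

  AllPairs-map∈ : ∀ {S : Rel A r} {xs} → AllPairs R xs →
    (∀ {x y} → x ∈ xs → y ∈ xs → R x y → S x y) → AllPairs S xs
  AllPairs-map∈ []         R⇒S = []
  AllPairs-map∈ (Rx ∷ Rxs) R⇒S =
    All.tabulate (λ y∈ → R⇒S (here refl) (there y∈) (All.lookup Rx y∈))
    ∷ AllPairs-map∈ Rxs (λ x∈ y∈ → R⇒S (there x∈) (there y∈))

  sorted-ext : Irreflexive _≡_ R → Asymmetric R → ∀ {xs ys} → AllPairs R xs → AllPairs R ys →
    (∀ {z} → z ∈ xs → z ∈ ys) → (∀ {z} → z ∈ ys → z ∈ xs) → xs ≡ ys
  sorted-ext irr asym [] [] _ _ = refl
  sorted-ext irr asym [] (_ ∷ _) _ ys⊆ with () ← ys⊆ (here refl)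
  sorted-ext irr asym (_ ∷ _) [] xs⊆ _ with () ← xs⊆ (here refl)
  sorted-ext irr asym {x ∷ xs} {y ∷ ys} (Rx ∷ Rxs) (Ry ∷ Rys) xs⊆ ys⊆ =
    cong₂ _∷_ x≡y (sorted-ext irr asym Rxs Rys tail⊆ tail⊇)
    where
    x≡y : x ≡ y
    x≡y with xs⊆ (here refl) | ys⊆ (here refl)
    ... | here x≡y | _         = x≡y
    ... | there _  | here y≡x  = sym y≡x
    ... | there x∈ | there y∈  = contradiction (All.lookup Rx y∈) (asym (All.lookup Ry x∈))
    tail⊆ : ∀ {z} → z ∈ xs → z ∈ ys
    tail⊆ z∈ with xs⊆ (there z∈)
    ... | here z≡y = contradiction (All.lookup Rx z∈) (irr (trans x≡y (sym z≡y)))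
    ... | there z∈′ = z∈′
    tail⊇ : ∀ {z} → z ∈ ys → z ∈ xs
    tail⊇ z∈ with ys⊆ (there z∈)
    ... | here z≡x = contradiction (All.lookup Ry z∈) (irr (trans (sym x≡y) (sym z≡x)))
    ... | there z∈′ = z∈′

injective⇒surjective : ∀ {m} (f : Fin m → Fin m) → (∀ i j → f i ≡ f j → i ≡ j) → ∀ k → ∃ λ i → f i ≡ k
injective⇒surjective {zero}  f inj ()
injective⇒surjective {suc m} f inj k with FP.any? (λ i → f i FP.≟ k)
... | yes hit = hit
... | no miss =
  let avoid : ∀ i → k ≢ f i
      avoid i k≡fi = miss (i , sym k≡fi)
      (i , j , i<j , gi≡gj) = FP.pigeonhole (ℕP.n<1+n m) (λ i → F.punchOut (avoid i))
  in contradiction (inj i j (FP.punchOut-injective (avoid i) (avoid j) gi≡gj)) (FP.<⇒≢ i<j)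

module _ {m} {P : Pred (Fin m) p} (P? : Decidable P) where

  max-satisfying : ∃ P → ∃ λ v → P v × ∀ w → P w → w F.≤ v
  max-satisfying (u , Pu) = go u Pu (>-wellFounded u)
    where
    go : ∀ u → P u → Acc F._>_ u → ∃ λ v → P v × ∀ w → P w → w F.≤ v
    go u Pu (acc rs) with FP.any? (λ w → (u FP.<? w) ×-dec P? w)
    ... | yes (w , u<w , Pw) = go w Pw (rs u<w)
    ... | no none = u , Pu , λ w Pw → ℕP.≮⇒≥ (λ u<w → none (w , u<w , Pw))

-- A relation on finitely many nodes in which a path r → z → c through a node z that is lower
-- than both ends can be shortcut to r → c has no cycles, hence a sink.
module _ {m k} {P : Pred (Fin m) p} {R : Rel (Fin m) r} (P? : Decidable P) (R? : Decidable₂ R)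
         (height : Fin m → Fin k)
         (height-injective : ∀ {z c} → P z → P c → height z ≡ height c → z ≡ c)
         (R-irrefl : ∀ {z} → ¬ R z z)
         (shortcut : ∀ {r z c} → P r → P z → P c → R r z → R z c →
                     height z F.≤ height r → height z F.≤ height c → R r c)
  where

  Sink : Fin m → Set _
  Sink z = P z × ∀ c → P c → ¬ R z c

  private
    Above : ℕ → Fin m → Set _
    Above H c = P c × H ≤ toℕ (height c)

    SinkAbove : ℕ → Fin m → Set _
    SinkAbove H z = Above H z × ∀ c → Above H c → ¬ R z c

    at-or-above : ∀ {H c} → Above H c → toℕ (height c) ≡ H ⊎ Above (suc H) c
    at-or-above {H} (Pc , H≤hc) with ℕP.m≤n⇒m<n∨m≡n H≤hc
    ... | inj₁ H<hc = inj₂ (Pc , H<hc)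
    ... | inj₂ H≡hc = inj₁ (sym H≡hc)

    at-z₀-or-above : ∀ {H z₀ c} → P z₀ → toℕ (height z₀) ≡ H → Above H c → c ≡ z₀ ⊎ Above (suc H) c
    at-z₀-or-above Pz₀ hz₀≡H Ac with at-or-above Ac
    ... | inj₁ hc≡H = inj₁ (height-injective (proj₁ Ac) Pz₀ (FP.toℕ-injective (trans hc≡H (sym hz₀≡H))))
    ... | inj₂ Ac′  = inj₂ Ac′

    -- z₀ is the only node at height H: either it is a sink or the sink above H is.
    sinkAbove-at : ∀ {H z₀} → P z₀ → toℕ (height z₀) ≡ H →
                   (∃ (Above (suc H)) → ∃ (SinkAbove (suc H))) → ∃ (SinkAbove H)
    sinkAbove-at {H} {z₀} Pz₀ hz₀≡H rec with FP.any? (λ c → P? c ×-dec (suc H ℕP.≤? toℕ (height c)))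
    ... | no nothing-above = z₀ , (Pz₀ , ℕP.≤-reflexive (sym hz₀≡H)) , z₀-sink
      where
      z₀-sink : ∀ c → Above H c → ¬ R z₀ c
      z₀-sink c Ac with at-z₀-or-above Pz₀ hz₀≡H Ac
      ... | inj₁ refl = R-irrefl
      ... | inj₂ Ac′  = contradiction (c , Ac′) nothing-above
    ... | yes above with rec above
    ...   | (w , (Pw , H<hw) , w-sink) with R? w z₀
    ...     | yes Rwz₀ = z₀ , (Pz₀ , ℕP.≤-reflexive (sym hz₀≡H)) , z₀-sink
      where
      z₀-sink : ∀ c → Above H c → ¬ R z₀ c
      z₀-sink c Ac with at-z₀-or-above Pz₀ hz₀≡H Ac
      ... | inj₁ refl = R-irrefl
      ... | inj₂ (Pc , H<hc) = λ Rz₀c → w-sink c (Pc , H<hc)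
            (shortcut Pw Pz₀ Pc Rwz₀ Rz₀c (subst (_≤ toℕ (height w)) (sym hz₀≡H) (ℕP.<⇒≤ H<hw))
                                           (subst (_≤ toℕ (height c)) (sym hz₀≡H) (ℕP.<⇒≤ H<hc)))
    ...     | no ¬Rwz₀ = w , (Pw , ℕP.<⇒≤ H<hw) , w-sink′
      where
      w-sink′ : ∀ c → Above H c → ¬ R w c
      w-sink′ c Ac with at-z₀-or-above Pz₀ hz₀≡H Ac
      ... | inj₁ refl = ¬Rwz₀
      ... | inj₂ Ac′  = w-sink c Ac′

    shift : ∀ {d H} → k ≤ suc d ℕ.+ H → k ≤ d ℕ.+ suc H
    shift {d} {H} = subst (k ≤_) (sym (ℕP.+-suc d H))

    sinkAbove : ∀ d H → k ≤ d ℕ.+ H → ∃ (Above H) → ∃ (SinkAbove H)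
    sinkAbove zero H k≤H (c , _ , H≤hc) =
      contradiction (ℕP.≤-trans k≤H H≤hc) (ℕP.<⇒≱ (FP.toℕ<n (height c)))
    sinkAbove (suc d) H k≤ (c , Ac) with FP.any? (λ z → P? z ×-dec (toℕ (height z) ℕP.≟ H))
    ... | no nothing-at-H =
      let strict : ∀ {c} → Above H c → Above (suc H) c
          strict {c} Ac = [ (λ hc≡H → contradiction (c , proj₁ Ac , hc≡H) nothing-at-H) , (λ Ac′ → Ac′) ]′
                            (at-or-above Ac)
          (z , Az , sink) = sinkAbove d (suc H) (shift k≤) (c , strict Ac)
      in z , (proj₁ Az , ℕP.<⇒≤ (proj₂ Az)) , λ c Ac → sink c (strict Ac)
    ... | yes (z₀ , Pz₀ , hz₀≡H) = sinkAbove-at Pz₀ hz₀≡H (sinkAbove d (suc H) (shift k≤))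

  sink-exists : ∃ P → ∃ Sink
  sink-exists (c , Pc) =
    let (z , (Pz , _) , sink) = sinkAbove k 0 (ℕP.≤-reflexive (sym (ℕP.+-identityʳ k))) (c , Pc , z≤n)
    in z , Pz , λ c Pc → sink c (Pc , z≤n)

module Positions {A : Set a} (_≟_ : DecidableEquality A) where

  entry : List A → ℕ → Maybe A
  entry []       _       = nothing
  entry (y ∷ ys) zero    = just y
  entry (y ∷ ys) (suc i) = entry ys i

  position : List A → A → ℕ
  position []       k = 0
  position (y ∷ ys) k with y ≟ k
  ... | yes _ = 0
  ... | no _  = suc (position ys k)

  entry-position : ∀ xs {k} → k ∈ xs → entry xs (position xs k) ≡ just k
  entry-position (y ∷ ys) {k} k∈ with y ≟ k
  entry-position (y ∷ ys) {k} k∈          | yes refl = refl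
  entry-position (y ∷ ys) {k} (here refl) | no y≢k   = contradiction refl y≢k
  entry-position (y ∷ ys) {k} (there k∈)  | no _     = entry-position ys k∈

  entry⇒∈ : ∀ xs {i k} → entry xs i ≡ just k → k ∈ xs
  entry⇒∈ (y ∷ ys) {zero}  refl = here refl
  entry⇒∈ (y ∷ ys) {suc i} e    = there (entry⇒∈ ys e)

  entry⇒< : ∀ xs {i k} → entry xs i ≡ just k → i ℕ.< length xs
  entry⇒< (y ∷ ys) {zero}  _ = s≤s z≤n
  entry⇒< (y ∷ ys) {suc i} e = s≤s (entry⇒< ys e)

  <⇒entry : ∀ xs {i} → i ℕ.< length xs → ∃ λ k → entry xs i ≡ just k
  <⇒entry (y ∷ ys) {zero}  _         = y , refl
  <⇒entry (y ∷ ys) {suc i} (s≤s i<) = <⇒entry ys i<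

  position< : ∀ xs {k} → k ∈ xs → position xs k ℕ.< length xs
  position< xs k∈ = entry⇒< xs (entry-position xs k∈)

  entry-functional : ∀ xs {i a b} → entry xs i ≡ just a → entry xs i ≡ just b → a ≡ b
  entry-functional xs ea eb = just-injective (trans (sym ea) eb)

  position-entry : ∀ xs {i k} → Unique xs → entry xs i ≡ just k → position xs k ≡ i
  position-entry (y ∷ ys) {zero}  _ refl with y ≟ y
  ... | yes _   = refl
  ... | no y≢y = contradiction refl y≢y
  position-entry (y ∷ ys) {suc i} {k} (y∉ys ∷ u) e with y ≟ k
  ... | yes refl = contradiction refl (All.lookup y∉ys (entry⇒∈ ys e))
  ... | no _     = cong suc (position-entry ys u e)

  entry-injective : ∀ xs {i j k} → Unique xs → entry xs i ≡ just k → entry xs j ≡ just k → i ≡ j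
  entry-injective xs u ei ej = trans (sym (position-entry xs u ei)) (position-entry xs u ej)

  injective-entry⇒unique : ∀ xs → (∀ {i j k} → entry xs i ≡ just k → entry xs j ≡ just k → i ≡ j) → Unique xs
  injective-entry⇒unique []       _   = []
  injective-entry⇒unique (y ∷ ys) inj =
    All.tabulate (λ k∈ y≡k → ℕP.0≢1+n (inj (cong just y≡k) (entry-position ys k∈)))
    ∷ injective-entry⇒unique ys (λ ei ej → ℕP.suc-injective (inj ei ej))

  entry-toList : ∀ {m} (xs : Vec A m) (i : Fin m) → entry (V.toList xs) (toℕ i) ≡ just (V.lookup xs i)
  entry-toList (y V.∷ ys) F.zero    = refl
  entry-toList (y V.∷ ys) (F.suc i) = entry-toList ys i

  entry-toList⁻ : ∀ {m} (xs : Vec A m) j {k} → entry (V.toList xs) j ≡ just k →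
    ∃ λ i → toℕ i ≡ j × V.lookup xs i ≡ k
  entry-toList⁻ (y V.∷ ys) zero    refl = F.zero , refl , refl
  entry-toList⁻ (y V.∷ ys) (suc j) e    = let (i , i≡j , at) = entry-toList⁻ ys j e in F.suc i , cong suc i≡j , at

  length-∷ʳ : (xs : List A) (v : A) → length (xs ∷ʳ v) ≡ suc (length xs)
  length-∷ʳ []       v = refl
  length-∷ʳ (y ∷ ys) v = cong suc (length-∷ʳ ys v)

  ∈-∷ʳ⁻ : (xs : List A) {v k : A} → k ∈ xs ∷ʳ v → k ∈ xs ⊎ k ≡ v
  ∈-∷ʳ⁻ xs k∈ with ∈-++⁻ xs k∈
  ... | inj₁ k∈xs       = inj₁ k∈xs
  ... | inj₂ (here k≡v) = inj₂ k≡v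

  ∈-∷ʳ-last : (xs : List A) (v : A) → v ∈ xs ∷ʳ v
  ∈-∷ʳ-last xs v = ∈-++⁺ʳ xs (here refl)

  entry-∷ʳ : ∀ (xs : List A) (v : A) {i} → i ℕ.< length xs → entry (xs ∷ʳ v) i ≡ entry xs i
  entry-∷ʳ (y ∷ ys) v {zero}  _         = refl
  entry-∷ʳ (y ∷ ys) v {suc i} (s≤s i<) = entry-∷ʳ ys v i<

  entry-∷ʳ-last : (xs : List A) (v : A) → entry (xs ∷ʳ v) (length xs) ≡ just v
  entry-∷ʳ-last []       v = refl
  entry-∷ʳ-last (y ∷ ys) v = entry-∷ʳ-last ys v

  entry-∷ʳ⁺ : ∀ (xs : List A) (v : A) {i k} → entry xs i ≡ just k → entry (xs ∷ʳ v) i ≡ just k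
  entry-∷ʳ⁺ xs v e = trans (entry-∷ʳ xs v (entry⇒< xs e)) e

  entry⇒∷ʳ : ∀ xs {j k} → suc j ≡ length xs → entry xs j ≡ just k → ∃ λ ys → xs ≡ ys ∷ʳ k
  entry⇒∷ʳ xs {j} len e with L.initLast xs
  ... | L.[] with () ← len
  ... | ys L.∷ʳ′ w = ys , cong (ys ∷ʳ_) (entry-functional (ys ∷ʳ w) last-at e)
    where
    last-at : entry (ys ∷ʳ w) j ≡ just w
    last-at = subst (λ j → entry (ys ∷ʳ w) j ≡ just w) (ℕP.suc-injective (trans (sym (length-∷ʳ ys w)) (sym len)))
                    (entry-∷ʳ-last ys w)

  position-∷ʳ : ∀ (xs : List A) (v : A) {k} → k ∈ xs → position (xs ∷ʳ v) k ≡ position xs k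
  position-∷ʳ (y ∷ ys) v {k} k∈ with y ≟ k
  position-∷ʳ (y ∷ ys) v {k} k∈          | yes _   = refl
  position-∷ʳ (y ∷ ys) v {k} (here refl) | no y≢k = contradiction refl y≢k
  position-∷ʳ (y ∷ ys) v {k} (there k∈)  | no _   = cong suc (position-∷ʳ ys v k∈)

  position-∷ʳ-last : (xs : List A) (v : A) → v ∉ xs → position (xs ∷ʳ v) v ≡ length xs
  position-∷ʳ-last []       v v∉ with v ≟ v
  ... | yes _   = refl
  ... | no v≢v = contradiction refl v≢v
  position-∷ʳ-last (y ∷ ys) v v∉ with y ≟ v
  ... | yes refl = contradiction (here refl) v∉
  ... | no _     = cong suc (position-∷ʳ-last ys v (λ v∈ → v∉ (there v∈)))

  ∷ʳ⁺-unique : (xs : List A) (v : A) → Unique xs → v ∉ xs → Unique (xs ∷ʳ v)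
  ∷ʳ⁺-unique []       v _          _  = [] ∷ []
  ∷ʳ⁺-unique (y ∷ ys) v (y∉ys ∷ u) v∉ =
    All.tabulate (λ k∈ → [ All.lookup y∉ys , (λ { refl refl → v∉ (here refl) }) ]′ (∈-∷ʳ⁻ ys k∈))
    ∷ ∷ʳ⁺-unique ys v u (λ v∈ → v∉ (there v∈))

  ∷ʳ⁻-unique : (xs : List A) (v : A) → Unique (xs ∷ʳ v) → Unique xs × v ∉ xs
  ∷ʳ⁻-unique []       v _          = [] , λ ()
  ∷ʳ⁻-unique (y ∷ ys) v (y∉ ∷ u) =
    let (u′ , v∉ys) = ∷ʳ⁻-unique ys v u in
    (All.tabulate (λ k∈ → All.lookup y∉ (∈-++⁺ˡ k∈)) ∷ u′) ,
    λ { (here refl) → All.lookup y∉ (∈-∷ʳ-last ys v) refl ; (there v∈) → v∉ys v∈ }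

  remove : A → List A → List A
  remove v []       = []
  remove v (y ∷ ys) with y ≟ v
  ... | yes _ = ys
  ... | no _  = y ∷ remove v ys

  ∈-remove⁻ : ∀ v xs {k} → Unique xs → k ∈ remove v xs → k ∈ xs × k ≢ v
  ∈-remove⁻ v (y ∷ ys) u k∈ with y ≟ v
  ∈-remove⁻ v (y ∷ ys) (y∉ ∷ _) k∈          | yes refl = there k∈ , λ { refl → All.lookup y∉ k∈ refl }
  ∈-remove⁻ v (y ∷ ys) u         (here refl) | no y≢v   = here refl , y≢v
  ∈-remove⁻ v (y ∷ ys) (_ ∷ u)   (there k∈)  | no _     =
    let (k∈ys , k≢v) = ∈-remove⁻ v ys u k∈ in there k∈ys , k≢v

  ∈-remove⁺ : ∀ v xs {k} → k ∈ xs → k ≢ v → k ∈ remove v xs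
  ∈-remove⁺ v (y ∷ ys) k∈ k≢v with y ≟ v
  ∈-remove⁺ v (y ∷ ys) (here refl) k≢v | yes y≡v = contradiction y≡v k≢v
  ∈-remove⁺ v (y ∷ ys) (there k∈)  k≢v | yes _   = k∈
  ∈-remove⁺ v (y ∷ ys) (here refl) k≢v | no _    = here refl
  ∈-remove⁺ v (y ∷ ys) (there k∈)  k≢v | no _    = there (∈-remove⁺ v ys k∈ k≢v)

  length-remove : ∀ v xs → v ∈ xs → suc (length (remove v xs)) ≡ length xs
  length-remove v (y ∷ ys) v∈ with y ≟ v
  length-remove v (y ∷ ys) v∈          | yes _   = refl
  length-remove v (y ∷ ys) (here refl) | no y≢v = contradiction refl y≢v
  length-remove v (y ∷ ys) (there v∈)  | no _   = cong suc (length-remove v ys v∈)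

  remove-unique : ∀ v xs → Unique xs → Unique (remove v xs)
  remove-unique v []       u = []
  remove-unique v (y ∷ ys) (y∉ ∷ u) with y ≟ v
  ... | yes _ = u
  ... | no _  = All.tabulate (λ k∈ → All.lookup y∉ (proj₁ (∈-remove⁻ v ys u k∈))) ∷ remove-unique v ys u

does-true⇒ : ∀ {P : Set} (P? : Dec P) → does P? ≡ true → P
does-true⇒ (yes p) _ = p

fromIrrelevant : ∀ {P : Set} → Dec P → Irrelevant P → P
fromIrrelevant P? [ p ] = recompute P? p

module Arcs (n : ℕ) where

  bit : Arc n → Fin n → Bool
  bit a k = lookup (sides a) k

  wellFormed? : (r : RawArc n) → Dec (WellFormedArc r)
  wellFormed? (p , q , left) =
    (p FP.<? q) ×-dec FP.all? (λ k → (lookup left k BoolP.≟ true) →-dec ((p FP.<? k) ×-dec (k FP.<? q)))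

  wellFormed : (a : Arc n) → WellFormedArc (value a)
  wellFormed a = fromIrrelevant (wellFormed? (value a)) (proof a)

  lo<hi : (a : Arc n) → lo a F.< hi a
  lo<hi a = proj₁ (wellFormed a)

  bit⇒between : (a : Arc n) {k : Fin n} → bit a k ≡ true → lo a F.< k × k F.< hi a
  bit⇒between a {k} = proj₂ (wellFormed a) k

  arc-≡ : (a c : Arc n) → lo a ≡ lo c → hi a ≡ hi c → (∀ k → bit a k ≡ bit c k) → a ≡ c
  arc-≡ a c lo≡ hi≡ bit≡ = value-injective (cong₂ _,_ lo≡ (cong₂ _,_ hi≡ sides≡))
    where
    sides≡ : sides a ≡ sides c
    sides≡ = trans (sym (VecP.tabulate∘lookup (sides a)))
                   (trans (VecP.tabulate-cong bit≡) (VecP.tabulate∘lookup (sides c)))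

  passesLeft⇒¬endsAt : ∀ a k → PassesLeftOf {n} a k → ¬ EndsAt a k
  passesLeft⇒¬endsAt a k (lo<k , _ , _) (inj₁ k≡lo) = FP.<⇒≢ lo<k (sym k≡lo)
  passesLeft⇒¬endsAt a k (_ , k<hi , _) (inj₂ k≡hi) = FP.<⇒≢ k<hi k≡hi

  passesRight⇒¬endsAt : ∀ a k → PassesRightOf {n} a k → ¬ EndsAt a k
  passesRight⇒¬endsAt a k (lo<k , _ , _) (inj₁ k≡lo) = FP.<⇒≢ lo<k (sym k≡lo)
  passesRight⇒¬endsAt a k (_ , k<hi , _) (inj₂ k≡hi) = FP.<⇒≢ k<hi k≡hi

  passesLeft⇒¬passesRight : ∀ a k → PassesLeftOf {n} a k → ¬ PassesRightOf a k
  passesLeft⇒¬passesRight a k (_ , _ , left) (_ , _ , right) = contradiction (trans (sym left) right) λ ()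

  passesLeftOf? : ∀ a k → Dec (PassesLeftOf {n} a k)
  passesLeftOf? a k = (lo a FP.<? k) ×-dec (k FP.<? hi a) ×-dec (bit a k BoolP.≟ true)

  passesRightOf? : ∀ a k → Dec (PassesRightOf {n} a k)
  passesRightOf? a k = (lo a FP.<? k) ×-dec (k FP.<? hi a) ×-dec (bit a k BoolP.≟ false)

  endsAt? : ∀ a k → Dec (EndsAt {n} a k)
  endsAt? a k = (k FP.≟ lo a) ⊎-dec (k FP.≟ hi a)

  strictlyLeftAt? : ∀ a b k → Dec (StrictlyLeftAt {n} a b k)
  strictlyLeftAt? a b k = (passesLeftOf? a k ×-dec endsAt? b k)
                    ⊎-dec (passesLeftOf? a k ×-dec passesRightOf? b k)
                    ⊎-dec (endsAt? a k ×-dec passesRightOf? b k)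

  cross? : ∀ a b → Dec (Cross {n} a b)
  cross? a b = FP.any? λ k → FP.any? λ k′ → strictlyLeftAt? a b k ×-dec strictlyLeftAt? b a k′

  isMatching? : (D : List (Arc n)) → Dec (IsMatching D)
  isMatching? D =
    AllPairs.allPairs? (λ a b → ¬? (cross? a b) ×-dec (lo a FP.<? lo b) ×-dec ¬? (hi a FP.≟ hi b)) D
    ×-dec AllPairs.allPairs? (λ a b → ¬? (lo a FP.≟ lo b) ×-dec ¬? (hi a FP.≟ hi b)
                                      ×-dec ¬? (lo a FP.≟ hi b) ×-dec ¬? (hi a FP.≟ lo b)) D

  cross-sym : ∀ {a b : Arc n} → Cross a b → Cross b a
  cross-sym (k , k′ , a<b , b<a) = k′ , k , b<a , a<b

  LoLt : Arc n → Arc n → Set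
  LoLt a b = lo a F.< lo b

  -- The part of NoncrossingPair × DisjointEndpoints that does not depend on the order of a and b.
  Compatible : Arc n → Arc n → Set
  Compatible a b = ¬ Cross a b × hi a ≢ hi b × lo a ≢ hi b × hi a ≢ lo b

  module _ {D : List (Arc n)} (M : IsMatching D) where

    matching-compatible : ∀ {a b} → a ∈ D → b ∈ D → lo a ≢ lo b → Compatible a b
    matching-compatible {a} {b} a∈ b∈ lo≢ with AllPairs-∈ (proj₁ M) a∈ b∈ | AllPairs-∈ (proj₂ M) a∈ b∈
    ... | inj₁ refl | _ = contradiction refl lo≢
    ... | _ | inj₁ refl = contradiction refl lo≢
    ... | inj₂ (inj₁ (nc , _ , hh)) | inj₂ (inj₁ (_ , _ , lh , hl)) = nc , hh , lh , hl
    ... | inj₂ (inj₁ (nc , _ , hh)) | inj₂ (inj₂ (_ , _ , lh , hl)) =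
      nc , hh , (λ e → hl (sym e)) , (λ e → lh (sym e))
    ... | inj₂ (inj₂ (nc , _ , hh)) | inj₂ (inj₁ (_ , _ , lh , hl)) =
      (λ c → nc (cross-sym {a} {b} c)) , (λ e → hh (sym e)) , lh , hl
    ... | inj₂ (inj₂ (nc , _ , hh)) | inj₂ (inj₂ (_ , _ , lh , hl)) =
      (λ c → nc (cross-sym {a} {b} c)) , (λ e → hh (sym e)) , (λ e → hl (sym e)) , (λ e → lh (sym e))

    matching-lo-injective : ∀ {a b} → a ∈ D → b ∈ D → lo a ≡ lo b → a ≡ b
    matching-lo-injective a∈ b∈ lo≡ with AllPairs-∈ (proj₁ M) a∈ b∈
    ... | inj₁ a≡b = a≡b
    ... | inj₂ (inj₁ (_ , lo< , _)) = contradiction lo≡ (FP.<⇒≢ lo<)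
    ... | inj₂ (inj₂ (_ , lo< , _)) = contradiction (sym lo≡) (FP.<⇒≢ lo<)

    matching-sorted : AllPairs LoLt D
    matching-sorted = AllPairs.map (λ { (_ , lo< , _) → lo< }) (proj₁ M)

  sorted-arcs-ext : ∀ {D E} → AllPairs LoLt D → AllPairs LoLt E →
    (∀ {a} → a ∈ D → a ∈ E) → (∀ {a} → a ∈ E → a ∈ D) → D ≡ E
  sorted-arcs-ext = sorted-ext (λ { refl → ℕP.<-irrefl refl }) ℕP.<-asym

  -- Deleting the point v (points are not renumbered): arcs starting at v disappear, the others forget v.
  clear : Fin n → Arc n → Arc n
  clear v a = record
    { value = lo a , hi a , sides a [ v ]≔ false
    ; proof = Irrelevant.map (λ (lo<hi , between) → lo<hi , λ k e → between k (cleared-true k e)) (proof a) }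
    where
    cleared-true : ∀ k → lookup (sides a [ v ]≔ false) k ≡ true → bit a k ≡ true
    cleared-true k e with k FP.≟ v
    ... | yes refl = contradiction (trans (sym e) (VecP.lookup∘update k (sides a) false)) λ ()
    ... | no k≢v   = trans (sym (VecP.lookup∘update′ k≢v (sides a) false)) e

  bit-clear : ∀ v a {k} → k ≢ v → bit (clear v a) k ≡ bit a k
  bit-clear v a k≢v = VecP.lookup∘update′ k≢v (sides a) false

  bit-clear-self : ∀ v a → bit (clear v a) v ≡ false
  bit-clear-self v a = VecP.lookup∘update v (sides a) false

  strictlyLeftAt-clear⁻ : ∀ v a b {k} → ¬ EndsAt a v → ¬ EndsAt b v →
    StrictlyLeftAt (clear v a) (clear v b) k → StrictlyLeftAt a b k
  strictlyLeftAt-clear⁻ v a b {k} a∌v b∌v a<b with k FP.≟ v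
  ... | yes refl = at-v a<b
    where
    cleared : ∀ c → ¬ PassesLeftOf (clear k c) k
    cleared c (_ , _ , left) = contradiction (trans (sym left) (bit-clear-self k c)) λ ()
    at-v : StrictlyLeftAt (clear k a) (clear k b) k → StrictlyLeftAt a b k
    at-v (inj₁ (l , _))         = contradiction l (cleared a)
    at-v (inj₂ (inj₁ (l , _)))  = contradiction l (cleared a)
    at-v (inj₂ (inj₂ (e , _)))  = contradiction e a∌v
  ... | no k≢v = restore a<b
    where
    left : ∀ c → PassesLeftOf (clear v c) k → PassesLeftOf c k
    left c (lo<k , k<hi , l) = lo<k , k<hi , trans (sym (bit-clear v c k≢v)) l
    right : ∀ c → PassesRightOf (clear v c) k → PassesRightOf c k
    right c (lo<k , k<hi , r) = lo<k , k<hi , trans (sym (bit-clear v c k≢v)) r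
    restore : StrictlyLeftAt (clear v a) (clear v b) k → StrictlyLeftAt a b k
    restore (inj₁ (l , e))         = inj₁ (left a l , e)
    restore (inj₂ (inj₁ (l , r)))  = inj₂ (inj₁ (left a l , right b r))
    restore (inj₂ (inj₂ (e , r)))  = inj₂ (inj₂ (e , right b r))

  survivor : Fin n → Arc n → Maybe (Arc n)
  survivor v a with lo a FP.≟ v
  ... | yes _ = nothing
  ... | no _  = just (clear v a)

  survivor-just : ∀ v a {a′} → survivor v a ≡ just a′ → lo a ≢ v × a′ ≡ clear v a
  survivor-just v a e with lo a FP.≟ v
  survivor-just v a refl | no lo≢v = lo≢v , refl

  survivor-≢ : ∀ v a → lo a ≢ v → survivor v a ≡ just (clear v a)
  survivor-≢ v a lo≢v with lo a FP.≟ v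
  ... | yes lo≡v = contradiction lo≡v lo≢v
  ... | no _     = refl

  deletePoint : Fin n → List (Arc n) → List (Arc n)
  deletePoint v = mapMaybe (survivor v)

  ∈-deletePoint⁻ : ∀ v D {a′} → a′ ∈ deletePoint v D → ∃ λ a → a ∈ D × lo a ≢ v × a′ ≡ clear v a
  ∈-deletePoint⁻ v D a′∈ =
    let (a , a∈ , e) = ∈-mapMaybe⁻ (survivor v) D a′∈ in a , a∈ , survivor-just v a e

  ∈-deletePoint⁺ : ∀ v D {a} → a ∈ D → lo a ≢ v → clear v a ∈ deletePoint v D
  ∈-deletePoint⁺ v D a∈ lo≢v = ∈-mapMaybe⁺ (survivor v) D a∈ (survivor-≢ v _ lo≢v)

  deletePoint-sorted : ∀ v {D} → AllPairs LoLt D → AllPairs LoLt (deletePoint v D)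
  deletePoint-sorted v = AllPairs-mapMaybe⁺ (survivor v) λ {a} {b} lo< ea eb →
    subst₂ LoLt (sym (proj₂ (survivor-just v a ea))) (sym (proj₂ (survivor-just v b eb))) lo<

  deletePoint-matching : ∀ v {D} → IsMatching D → (∀ {a} → a ∈ D → hi a ≢ v) → IsMatching (deletePoint v D)
  deletePoint-matching v {D} M hi≢v =
    AllPairs-map∈ sorted noncrossing , AllPairs-map∈ sorted disjoint
    where
    sorted : AllPairs LoLt (deletePoint v D)
    sorted = deletePoint-sorted v (matching-sorted M)
    avoids : ∀ {a} → a ∈ D → lo a ≢ v → ¬ EndsAt a v
    avoids a∈ lo≢v (inj₁ v≡lo) = lo≢v (sym v≡lo)
    avoids a∈ lo≢v (inj₂ v≡hi) = hi≢v a∈ (sym v≡hi)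
    noncrossing : ∀ {a′ b′} → a′ ∈ deletePoint v D → b′ ∈ deletePoint v D → LoLt a′ b′ → NoncrossingPair a′ b′
    noncrossing a′∈ b′∈ lo< with ∈-deletePoint⁻ v D a′∈ | ∈-deletePoint⁻ v D b′∈
    ... | a , a∈ , la , refl | b , b∈ , lb , refl =
      let (nc , hh , _ , _) = matching-compatible M a∈ b∈ (FP.<⇒≢ lo<)
          a∌v = avoids a∈ la ; b∌v = avoids b∈ lb
      in (λ { (k , k′ , a<b , b<a) → nc (k , k′ , strictlyLeftAt-clear⁻ v a b a∌v b∌v a<b
                                                 , strictlyLeftAt-clear⁻ v b a b∌v a∌v b<a) })
         , lo< , hh
    disjoint : ∀ {a′ b′} → a′ ∈ deletePoint v D → b′ ∈ deletePoint v D → LoLt a′ b′ → DisjointEndpoints a′ b′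
    disjoint a′∈ b′∈ lo< with ∈-deletePoint⁻ v D a′∈ | ∈-deletePoint⁻ v D b′∈
    ... | a , a∈ , _ , refl | b , b∈ , _ , refl =
      let (_ , hh , lh , hl) = matching-compatible M a∈ b∈ (FP.<⇒≢ lo<)
      in (FP.<⇒≢ lo<) , hh , lh , hl

module DescentArcs (n : ℕ) where
  open Arcs n
  open Positions (FP._≟_ {n})
  open import Data.List.Membership.DecPropositional (FP._≟_ {n}) using (_∈?_)

  Word : Set
  Word = List (Fin n)

  LeftOf : Word → Fin n → Fin n → Fin n → Set
  LeftOf x p q k = p F.< k × k F.< q × k ∈ x × position x p ℕ.< position x k

  leftOf? : ∀ x p q k → Dec (LeftOf x p q k)
  leftOf? x p q k = (p FP.<? k) ×-dec (k FP.<? q) ×-dec (k ∈? x) ×-dec (position x p ℕP.<? position x k)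

  leftSet : Word → Fin n → Fin n → Vec Bool n
  leftSet x p q = tabulate (λ k → does (leftOf? x p q k))

  leftSet-true⇒ : ∀ x p q {k} → lookup (leftSet x p q) k ≡ true → LeftOf x p q k
  leftSet-true⇒ x p q {k} e = does-true⇒ (leftOf? x p q k) (trans (sym (VecP.lookup∘tabulate _ k)) e)

  leftSet-true⇐ : ∀ x p q {k} → LeftOf x p q k → lookup (leftSet x p q) k ≡ true
  leftSet-true⇐ x p q {k} l = trans (VecP.lookup∘tabulate _ k) (dec-true (leftOf? x p q k) l)

  descentArc : (x : Word) (p q : Fin n) → .(p F.< q) → Arc n
  descentArc x p q p<q = record
    { value = p , q , leftSet x p q
    ; proof = [ (p<q , λ k e → let (p<k , k<q , _) = leftSet-true⇒ x p q e in p<k , k<q) ] }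

  record Descent (x : Word) : Set where
    constructor descent
    field
      index         : ℕ
      {top bottom}  : Fin n
      top-at        : entry x index ≡ just top
      bottom-at     : entry x (suc index) ≡ just bottom
      bottom<top    : bottom F.< top

  arcOf : ∀ {x} → Descent x → Arc n
  arcOf {x} (descent _ {q} {p} _ _ p<q) = descentArc x p q p<q

  arcStartingAt : Word → Fin n → Maybe (Arc n)
  arcStartingAt x p with p ∈? x | position x p
  ... | no _  | _     = nothing
  ... | yes _ | zero  = nothing
  ... | yes _ | suc i with entry x i
  ...   | nothing = nothing
  ...   | just q with p FP.<? q
  ...     | yes p<q = just (descentArc x p q p<q)
  ...     | no _    = nothing

  arcStartingAt-just : ∀ x p {a} → arcStartingAt x p ≡ just a →
    Σ (Descent x) λ d → Descent.bottom d ≡ p × a ≡ arcOf d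
  arcStartingAt-just x p e with p ∈? x | position x p in pos
  ... | yes p∈ | suc i with entry x i in top
  ...   | just q with p FP.<? q
  arcStartingAt-just x p refl | yes p∈ | suc i | just q | yes p<q =
    descent i top (subst (λ j → entry x j ≡ just p) pos (entry-position x p∈)) p<q , refl , refl

  arcStartingAt-descent : ∀ {x} → Unique x → (d : Descent x) → arcStartingAt x (Descent.bottom d) ≡ just (arcOf d)
  arcStartingAt-descent {x} u (descent i {q} {p} top-at bottom-at p<q) with p ∈? x
  ... | no p∉ = contradiction (entry⇒∈ x bottom-at) p∉
  ... | yes _ rewrite position-entry x u bottom-at | top-at with p FP.<? q
  ...   | yes _   = refl
  ...   | no p≮q = contradiction p<q p≮q

  δ : Word → List (Arc n)
  δ x = mapMaybe (arcStartingAt x) (allFin n)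

  ∈-δ⁻ : ∀ x {a} → a ∈ δ x → Σ (Descent x) λ d → a ≡ arcOf d
  ∈-δ⁻ x a∈ = let (p , _ , e) = ∈-mapMaybe⁻ (arcStartingAt x) (allFin n) a∈
                  (d , _ , a≡) = arcStartingAt-just x p e
              in d , a≡

  ∈-δ⁺ : ∀ {x} → Unique x → (d : Descent x) → arcOf d ∈ δ x
  ∈-δ⁺ {x} u d = ∈-mapMaybe⁺ (arcStartingAt x) (allFin n) (∈-allFin _) (arcStartingAt-descent u d)

  δ-sorted : ∀ x → AllPairs LoLt (δ x)
  δ-sorted x = AllPairs-mapMaybe⁺ (arcStartingAt x) lo-order (AllPairsP.tabulate⁺-< (λ i<j → i<j))
    where
    lo-order : ∀ {p p′ a a′} → p F.< p′ → arcStartingAt x p ≡ just a → arcStartingAt x p′ ≡ just a′ → LoLt a a′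
    lo-order p<p′ e e′ with arcStartingAt-just x _ e | arcStartingAt-just x _ e′
    ... | _ , refl , refl | _ , refl , refl = p<p′

  leftSet-false⇒ : ∀ x p q {k} → lookup (leftSet x p q) k ≡ false → ¬ LeftOf x p q k
  leftSet-false⇒ x p q e l = contradiction (trans (sym (leftSet-true⇐ x p q l)) e) λ ()

  -- Going up through k, the arc of a descent at positions (i, i+1) has on its left exactly the
  -- points of x after position i+1; an endpoint of a later descent sits at position > i.
  later-descent-not-left : ∀ {x} → Unique x → (d d′ : Descent x) → Descent.index d ℕ.< Descent.index d′ →
                           ∀ k → ¬ StrictlyLeftAt (arcOf d′) (arcOf d) k
  later-descent-not-left {x} u (descent i {q} {p} q-at p-at p<q) (descent j {q′} {p′} q′-at p′-at p′<q′) i<j k =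
    λ { (inj₁ (left′ , ends)) → ℕP.<⇒≱ (after-d′ left′) (ends-d ends)
      ; (inj₂ (inj₁ (left′ , right))) →
          ℕP.<⇒≱ (after-d′ left′)
            (right-d right (proj₁ (proj₂ (proj₂ (leftSet-true⇒ x p′ q′ (proj₂ (proj₂ left′)))))))
      ; (inj₂ (inj₂ (ends′ , right))) → ℕP.<⇒≱ (right-below-d right ends′) (ends-d′ ends′) }
    where
    pos-p : position x p ≡ suc i
    pos-p = position-entry x u p-at
    pos-q : position x q ≡ i
    pos-q = position-entry x u q-at
    pos-p′ : position x p′ ≡ suc j
    pos-p′ = position-entry x u p′-at
    pos-q′ : position x q′ ≡ j
    pos-q′ = position-entry x u q′-at
    ends-d : EndsAt (descentArc x p q p<q) k → position x k ≤ suc i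
    ends-d (inj₁ refl) = ℕP.≤-reflexive pos-p
    ends-d (inj₂ refl) = ℕP.≤-trans (ℕP.≤-reflexive pos-q) (ℕP.n≤1+n i)
    ends-d′ : EndsAt (descentArc x p′ q′ p′<q′) k → j ≤ position x k
    ends-d′ (inj₁ refl) = ℕP.≤-trans (ℕP.n≤1+n j) (ℕP.≤-reflexive (sym pos-p′))
    ends-d′ (inj₂ refl) = ℕP.≤-reflexive (sym pos-q′)
    after-d′ : PassesLeftOf (descentArc x p′ q′ p′<q′) k → suc i ℕ.< position x k
    after-d′ (_ , _ , l) =
      ℕP.<-trans (s≤s i<j) (subst (ℕ._< position x k) pos-p′ (proj₂ (proj₂ (proj₂ (leftSet-true⇒ x p′ q′ l)))))
    right-d : PassesRightOf (descentArc x p q p<q) k → k ∈ x → position x k ≤ suc i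
    right-d (p<k , k<q , r) k∈ =
      subst (position x k ≤_) pos-p (ℕP.≮⇒≥ λ lt → leftSet-false⇒ x p q r (p<k , k<q , k∈ , lt))
    right-below-d : PassesRightOf (descentArc x p q p<q) k → EndsAt (descentArc x p′ q′ p′<q′) k →
                    position x k ℕ.< j
    right-below-d right@(p<k , k<q , _) ends′ =
      ℕP.<-≤-trans (ℕP.≤∧≢⇒< (ℕP.≤-pred (ℕP.≤∧≢⇒< (right-d right k∈) k≢p)) k≢q) (ℕP.<⇒≤ i<j)
      where
      k∈ : k ∈ x
      k∈ = [ (λ { refl → entry⇒∈ x p′-at }) , (λ { refl → entry⇒∈ x q′-at }) ]′ ends′
      k≢p : position x k ≢ suc i
      k≢p e = FP.<⇒≢ p<k (entry-functional x p-at (subst (λ j → entry x j ≡ just k) e (entry-position x k∈)))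
      k≢q : position x k ≢ i
      k≢q e = FP.<⇒≢ k<q (entry-functional x (subst (λ j → entry x j ≡ just k) e (entry-position x k∈)) q-at)

  NoConsecutive321 : Word → Set
  NoConsecutive321 x = ∀ i {a b c} → entry x i ≡ just a → entry x (suc i) ≡ just b →
                       entry x (suc (suc i)) ≡ just c →
                       b F.< a → ¬ c F.< b

  descents-compatible : ∀ {x} → Unique x → NoConsecutive321 x → (d d′ : Descent x) →
                        Descent.bottom d ≢ Descent.bottom d′ → Compatible (arcOf d) (arcOf d′)
  descents-compatible {x} u no321 d@(descent i {q} {p} q-at p-at p<q)
                      d′@(descent j {q′} {p′} q′-at p′-at p′<q′) p≢p′ =
    noncrossing , tops-differ , p≢q′ , q≢p′
    where
    same-index⇒same-bottom : i ≡ j → p ≡ p′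
    same-index⇒same-bottom refl = entry-functional x p-at p′-at
    noncrossing : ¬ Cross (arcOf d) (arcOf d′)
    noncrossing (k , k′ , d<d′ , d′<d) with ℕP.<-cmp i j
    ... | tri< i<j _ _ = later-descent-not-left u d d′ i<j k′ d′<d
    ... | tri≈ _ i≡j _ = p≢p′ (same-index⇒same-bottom i≡j)
    ... | tri> _ _ j<i = later-descent-not-left u d′ d j<i k d<d′
    tops-differ : q ≢ q′
    tops-differ refl = p≢p′ (same-index⇒same-bottom (entry-injective x u q-at q′-at))
    p≢q′ : p ≢ q′
    p≢q′ refl with entry-injective x u p-at q′-at
    ... | refl = no321 i q-at p-at p′-at p<q p′<q′
    q≢p′ : q ≢ p′
    q≢p′ refl with entry-injective x u p′-at q-at
    ... | refl = no321 j q′-at p′-at p-at p′<q′ p<q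

  δ-matching : ∀ {x} → Unique x → NoConsecutive321 x → IsMatching (δ x)
  δ-matching {x} u no321 = AllPairs-map∈ (δ-sorted x) noncrossing , AllPairs-map∈ (δ-sorted x) disjoint
    where
    compatible : ∀ {a b} → a ∈ δ x → b ∈ δ x → LoLt a b → Compatible a b
    compatible a∈ b∈ lo< with ∈-δ⁻ x a∈ | ∈-δ⁻ x b∈
    ... | d , refl | d′ , refl = descents-compatible u no321 d d′ (FP.<⇒≢ lo<)
    noncrossing : ∀ {a b} → a ∈ δ x → b ∈ δ x → LoLt a b → NoncrossingPair a b
    noncrossing a∈ b∈ lo< = let (nc , hh , _) = compatible a∈ b∈ lo< in nc , lo< , hh
    disjoint : ∀ {a b} → a ∈ δ x → b ∈ δ x → LoLt a b → DisjointEndpoints a b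
    disjoint a∈ b∈ lo< = let (_ , hh , lh , hl) = compatible a∈ b∈ lo< in FP.<⇒≢ lo< , hh , lh , hl

  module _ (x′ : Word) (v : Fin n) (v∉x′ : v ∉ x′) where

    private
      x : Word
      x = x′ ∷ʳ v

    leftOf-∷ʳ : ∀ {p q k} → p ∈ x′ → k ≢ v → lookup (leftSet x p q) k ≡ lookup (leftSet x′ p q) k
    leftOf-∷ʳ {p} {q} {k} p∈ k≢v =
      trans (VecP.lookup∘tabulate _ k)
            (trans (does-⇔ (mk⇔ to from) (leftOf? x p q k) (leftOf? x′ p q k)) (sym (VecP.lookup∘tabulate _ k)))
      where
      to : LeftOf x p q k → LeftOf x′ p q k
      to (p<k , k<q , k∈ , lt) with ∈-∷ʳ⁻ x′ k∈
      ... | inj₁ k∈x′ = p<k , k<q , k∈x′ , subst₂ ℕ._<_ (position-∷ʳ x′ v p∈) (position-∷ʳ x′ v k∈x′) lt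
      ... | inj₂ k≡v  = contradiction k≡v k≢v
      from : LeftOf x′ p q k → LeftOf x p q k
      from (p<k , k<q , k∈ , lt) =
        p<k , k<q , ∈-++⁺ˡ k∈ , subst₂ ℕ._<_ (sym (position-∷ʳ x′ v p∈)) (sym (position-∷ʳ x′ v k∈)) lt

    leftOf-∷ʳ-last : ∀ {p q} → p ∈ x′ → p F.< v → v F.< q → lookup (leftSet x p q) v ≡ true
    leftOf-∷ʳ-last {p} {q} p∈ p<v v<q =
      leftSet-true⇐ x p q (p<v , v<q , ∈-∷ʳ-last x′ v ,
        subst₂ ℕ._<_ (sym (position-∷ʳ x′ v p∈)) (sym (position-∷ʳ-last x′ v v∉x′)) (position< x′ p∈))

    nothing-left-of-last : ∀ q k → lookup (leftSet x v q) k ≡ false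
    nothing-left-of-last q k = BoolP.¬-not λ e →
      let (_ , _ , k∈ , lt) = leftSet-true⇒ x v q e
      in ℕP.<⇒≱ (subst (ℕ._< position x k) (position-∷ʳ-last x′ v v∉x′) lt)
                (ℕP.≤-pred (subst (position x k ℕ.<_) (length-∷ʳ x′ v) (position< x k∈)))

    clear-descentArc-∷ʳ : ∀ {p q} .(p<q : p F.< q) → p ∈ x′ →
      clear v (descentArc x p q p<q) ≡ descentArc x′ p q p<q
    clear-descentArc-∷ʳ {p} {q} p<q p∈ = arc-≡ _ _ refl refl bits
      where
      bits : ∀ k → bit (clear v (descentArc x p q p<q)) k ≡ lookup (leftSet x′ p q) k
      bits k with k FP.≟ v
      ... | yes refl = trans (bit-clear-self v (descentArc x p q p<q))
                         (sym (BoolP.¬-not λ e → v∉x′ (proj₁ (proj₂ (proj₂ (leftSet-true⇒ x′ p q e))))))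
      ... | no k≢v  = trans (bit-clear v (descentArc x p q p<q) k≢v) (leftOf-∷ʳ {q = q} p∈ k≢v)

    descent-∷ʳ⁺ : Descent x′ → Descent x
    descent-∷ʳ⁺ (descent i q-at p-at p<q) = descent i (entry-∷ʳ⁺ x′ v q-at) (entry-∷ʳ⁺ x′ v p-at) p<q

    descent-∷ʳ⁻ : (d : Descent x) → Descent.bottom d ≢ v →
      Σ (Descent x′) λ d′ → Descent.bottom d′ ≡ Descent.bottom d
        × Descent.top d′ ≡ Descent.top d
    descent-∷ʳ⁻ (descent i q-at p-at p<q) p≢v =
      descent i (down q-at (ℕP.<-trans (ℕP.n<1+n i) i+1<)) (down p-at i+1<) p<q , refl , refl
      where
      down : ∀ {j k} → entry x j ≡ just k → j ℕ.< length x′ → entry x′ j ≡ just k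
      down e j< = trans (sym (entry-∷ʳ x′ v j<)) e
      i+1< : suc i ℕ.< length x′
      i+1< = ℕP.≤∧≢⇒< (ℕP.≤-pred (subst (suc i ℕ.<_) (length-∷ʳ x′ v) (entry⇒< x p-at)))
                    (λ e → p≢v (entry-functional x p-at
                          (subst (λ j → entry x j ≡ just v) (sym e) (entry-∷ʳ-last x′ v))))

  δ-∷ʳ : ∀ x′ v → Unique (x′ ∷ʳ v) → δ x′ ≡ deletePoint v (δ (x′ ∷ʳ v))
  δ-∷ʳ x′ v u = sorted-arcs-ext (δ-sorted x′) (deletePoint-sorted v (δ-sorted (x′ ∷ʳ v))) to from
    where
    u′ : Unique x′
    u′ = proj₁ (∷ʳ⁻-unique x′ v u)
    v∉x′ : v ∉ x′
    v∉x′ = proj₂ (∷ʳ⁻-unique x′ v u)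
    to : ∀ {a} → a ∈ δ x′ → a ∈ deletePoint v (δ (x′ ∷ʳ v))
    to a∈ with ∈-δ⁻ x′ a∈
    ... | d@(descent i {q} {p} _ p-at p<q) , refl =
      let p∈ = entry⇒∈ x′ p-at in
      subst (_∈ deletePoint v (δ (x′ ∷ʳ v))) (clear-descentArc-∷ʳ x′ v v∉x′ p<q p∈)
            (∈-deletePoint⁺ v (δ (x′ ∷ʳ v)) (∈-δ⁺ u (descent-∷ʳ⁺ x′ v v∉x′ d)) λ { refl → v∉x′ p∈ })
    from : ∀ {a} → a ∈ deletePoint v (δ (x′ ∷ʳ v)) → a ∈ δ x′
    from a∈ with ∈-deletePoint⁻ v (δ (x′ ∷ʳ v)) a∈
    ... | a , a∈δ , lo≢v , refl with ∈-δ⁻ (x′ ∷ʳ v) a∈δ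
    ...   | d , refl with descent-∷ʳ⁻ x′ v v∉x′ d lo≢v
    ...     | d′@(descent _ {q} {p} _ p-at p<q) , refl , refl =
      subst (_∈ δ x′) (sym (clear-descentArc-∷ʳ x′ v v∉x′ p<q (entry⇒∈ x′ p-at))) (∈-δ⁺ u′ d′)

  no321-∷ʳ⁻ : ∀ x′ v → NoConsecutive321 (x′ ∷ʳ v) → NoConsecutive321 x′
  no321-∷ʳ⁻ x′ v no321 i ea eb ec = no321 i (entry-∷ʳ⁺ x′ v ea) (entry-∷ʳ⁺ x′ v eb) (entry-∷ʳ⁺ x′ v ec)

module Candidates (n : ℕ) where
  open Arcs n
  open DescentArcs n
  open Positions (FP._≟_ {n})
  open import Data.List.Membership.DecPropositional (FP._≟_ {n}) using (_∈?_)

  IsTop : List (Arc n) → Fin n → Set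
  IsTop D v = Any (λ a → hi a ≡ v) D

  isTop? : ∀ D v → Dec (IsTop D v)
  isTop? D v = Any.any? (λ a → hi a FP.≟ v) D

  HasArcAt : List (Arc n) → Fin n → Set
  HasArcAt D v = Any (λ a → lo a ≡ v) D

  hasArcAt? : ∀ D v → Dec (HasArcAt D v)
  hasArcAt? D v = Any.any? (λ a → lo a FP.≟ v) D

  -- v is a candidate for the last letter of a word over s whose diagram is D.
  record Candidate (D : List (Arc n)) (s : Word) (v : Fin n) : Set where
    constructor candidate
    field
      in-support     : v ∈ s
      not-top        : ¬ IsTop D v
      passed-on-left : ∀ {a} → a ∈ D → lo a F.< v → v F.< hi a → bit a v ≡ true
      nothing-left   : ∀ {a} → a ∈ D → lo a ≡ v → ∀ k → bit a k ≡ false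

  candidate? : ∀ D s v → Dec (Candidate D s v)
  candidate? D s v = map′ (λ (c₁ , c₂ , c₃ , c₄) → candidate c₁ c₂ (All.lookup c₃) (All.lookup c₄))
                          (λ (candidate c₁ c₂ c₃ c₄) → c₁ , c₂ , All.tabulate c₃ , All.tabulate c₄)
    ((v ∈? s) ×-dec ¬? (isTop? D v)
     ×-dec All.all? (λ a → (lo a FP.<? v) →-dec ((v FP.<? hi a) →-dec (bit a v BoolP.≟ true))) D
     ×-dec All.all? (λ a → (lo a FP.≟ v) →-dec FP.all? (λ k → bit a k BoolP.≟ false)) D)

  -- A discrete intermediate value argument.
  descent-across : ∀ x′ v {w} → v F.< w → ∀ d {i y} → i ℕ.+ d ≡ length x′ →
    entry (x′ ∷ʳ v) i ≡ just y → w F.< y → (∀ {m} → entry (x′ ∷ʳ v) m ≡ just w → m ℕ.< i) →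
    ∃ λ m → ∃ λ y₁ → ∃ λ y₂ → i ≤ m × entry (x′ ∷ʳ v) m ≡ just y₁ × entry (x′ ∷ʳ v) (suc m) ≡ just y₂
                               × y₂ F.< w × w F.< y₁
  descent-across x′ v {w} v<w zero {i} i≡L y-at w<y _ =
    contradiction w<y (FP.<-asym (subst (F._< w) (entry-functional (x′ ∷ʳ v) last-at y-at) v<w))
    where
    last-at : entry (x′ ∷ʳ v) i ≡ just v
    last-at = subst (λ j → entry (x′ ∷ʳ v) j ≡ just v) (trans (sym i≡L) (ℕP.+-identityʳ i)) (entry-∷ʳ-last x′ v)
  descent-across x′ v {w} v<w (suc d) {i} {y} i+d≡L y-at w<y w-before
    with <⇒entry (x′ ∷ʳ v) {suc i} (subst (suc i ℕ.<_) (sym (length-∷ʳ x′ v))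
                                          (s≤s (subst (i ℕ.<_) i+d≡L (ℕP.m<m+n i (s≤s z≤n)))))
  ... | y′ , y′-at with FP.<-cmp y′ w
  ...   | tri< y′<w _ _ = i , y , y′ , ℕP.≤-refl , y-at , y′-at , y′<w , w<y
  ...   | tri≈ _ refl _ = contradiction (w-before y′-at) (ℕP.<-asym (ℕP.n<1+n i))
  ...   | tri> _ _ w<y′ =
    let (m , y₁ , y₂ , i+1≤m , rest) = descent-across x′ v v<w d (trans (sym (ℕP.+-suc i d)) i+d≡L) y′-at w<y′
                                          (λ w-at → ℕP.<-trans (w-before w-at) (ℕP.n<1+n i))
    in m , y₁ , y₂ , ℕP.<⇒≤ i+1≤m , rest

  module LastLetter (x′ : Word) (v : Fin n) (u : Unique (x′ ∷ʳ v)) where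

    private
      x : Word
      x = x′ ∷ʳ v
      L : ℕ
      L = length x′
      v∉x′ : v ∉ x′
      v∉x′ = proj₂ (∷ʳ⁻-unique x′ v u)
      v-at : entry x L ≡ just v
      v-at = entry-∷ʳ-last x′ v
      ≤L : ∀ {i k} → entry x i ≡ just k → i ≤ L
      ≤L e = ℕP.≤-pred (subst (_ ℕ.<_) (length-∷ʳ x′ v) (entry⇒< x e))
      at-L : ∀ {i k} → entry x i ≡ just k → i ≡ L → k ≡ v
      at-L e refl = entry-functional x e v-at

    last-letter-candidate : ∀ {s} → v ∈ s → Candidate (δ x) s v
    last-letter-candidate v∈s = candidate v∈s not-top passed-on-left nothing-left
      where
      not-top : ¬ IsTop (δ x) v
      not-top is-top with find is-top
      ... | a , a∈ , hi≡v with ∈-δ⁻ x a∈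
      ... | descent i q-at p-at _ , refl =
        ℕP.<-irrefl refl (subst (λ j → suc j ≤ L)
                                  (entry-injective x u q-at (subst (λ z → entry x L ≡ just z) (sym hi≡v) v-at))
                                (≤L p-at))
      passed-on-left : ∀ {a} → a ∈ δ x → lo a F.< v → v F.< hi a → bit a v ≡ true
      passed-on-left a∈ p<v v<q with ∈-δ⁻ x a∈
      ... | descent i {q} {p} _ p-at _ , refl =
        leftSet-true⇐ x p q (p<v , v<q , entry⇒∈ x v-at ,
          subst₂ ℕ._<_ (sym (position-entry x u p-at)) (sym (position-entry x u v-at))
                 (ℕP.≤∧≢⇒< (≤L p-at) λ i+1≡L → FP.<⇒≢ p<v (at-L p-at i+1≡L)))
      nothing-left : ∀ {a} → a ∈ δ x → lo a ≡ v → ∀ k → bit a k ≡ false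
      nothing-left a∈ lo≡v k with ∈-δ⁻ x a∈
      ... | descent _ {q} _ _ _ , refl =
        subst (λ p → lookup (leftSet x p q) k ≡ false) (sym lo≡v) (nothing-left-of-last x′ v v∉x′ q k)

    -- A larger candidate w would be followed by a larger letter (else w tops a descent arc), and then
    -- the word steps down across w later; that descent's arc has w on its right.
    last-letter-maximal : ∀ {s} → (∀ {k} → k ∈ s → k ∈ x) → ∀ {w} → Candidate (δ x) s w → w F.≤ v
    last-letter-maximal s⊆x {w} (candidate w∈s w-not-top w-left _) = ℕP.≮⇒≥ larger-impossible
      where
      w∈ : w ∈ x
      w∈ = s⊆x w∈s
      j : ℕ
      j = position x w
      w-at : entry x j ≡ just w
      w-at = entry-position x w∈
      j<L : v F.< w → j ℕ.< L
      j<L v<w = ℕP.≤∧≢⇒< (≤L w-at) λ j≡L → FP.<⇒≢ v<w (sym (at-L w-at j≡L))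
      larger-impossible : v F.< w → ⊥
      larger-impossible v<w with <⇒entry x {suc j} (subst (suc j ℕ.<_) (sym (length-∷ʳ x′ v)) (s≤s (j<L v<w)))
      ... | w′ , w′-at with FP.<-cmp w′ w
      ...   | tri< w′<w _ _ = w-not-top (lose (∈-δ⁺ u (descent j w-at w′-at w′<w)) refl)
      ...   | tri≈ _ refl _ = ℕP.1+n≢n (entry-injective x u w′-at w-at)
      ...   | tri> _ _ w<w′
        with descent-across x′ v v<w (L ℕ.∸ suc j) (ℕP.m+[n∸m]≡n (j<L v<w)) w′-at w<w′
               (λ w-at′ → s≤s (ℕP.≤-reflexive (entry-injective x u w-at′ w-at)))
      ...     | m , y₁ , y₂ , j<m , y₁-at , y₂-at , y₂<w , w<y₁ =
        let (_ , _ , _ , lt) = leftSet-true⇒ x y₂ y₁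
                                 (w-left (∈-δ⁺ u (descent m y₁-at y₂-at (FP.<-trans y₂<w w<y₁))) y₂<w w<y₁)
        in ℕP.<-asym j<m (ℕP.<-trans (ℕP.n<1+n m) (subst (ℕ._< j) (position-entry x u y₂-at) lt))

module CandidateExists (n : ℕ) where
  open Arcs n
  open DescentArcs n
  open Candidates n
  open import Data.List.Membership.DecPropositional (FP._≟_ {n}) using (_∈?_)

  Supported : List (Arc n) → Word → Set
  Supported D s = ∀ {a} → a ∈ D → lo a ∈ s × hi a ∈ s × (∀ k → bit a k ≡ true → k ∈ s)

  -- Every point r of s that is not a top heads a block: the arc of D starting at r, or r alone.
  module Blocks (D : List (Arc n)) (s : Word) (M : IsMatching D) (S : Supported D s) where

    Head : Fin n → Set
    Head r = r ∈ s × ¬ IsTop D r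

    BlockPassesLeftOf BlockPassesRightOf BlockEndsAt : Fin n → Fin n → Set
    BlockPassesLeftOf r k  = Any (λ a → lo a ≡ r × PassesLeftOf a k) D
    BlockPassesRightOf r k = Any (λ a → lo a ≡ r × PassesRightOf a k) D
    BlockEndsAt r k        = k ≡ r ⊎ Any (λ a → lo a ≡ r × hi a ≡ k) D

    BlockLeftAt : Fin n → Fin n → Fin n → Set
    BlockLeftAt r r′ k = (BlockPassesLeftOf r k × BlockEndsAt r′ k)
                       ⊎ (BlockPassesLeftOf r k × BlockPassesRightOf r′ k)
                       ⊎ (BlockEndsAt r k × BlockPassesRightOf r′ k)

    LeftOfBlock : Fin n → Fin n → Set
    LeftOfBlock r r′ = ∃ (BlockLeftAt r r′)

    head? : ∀ r → Dec (Head r)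
    head? r = (r ∈? s) ×-dec ¬? (isTop? D r)

    blockPassesLeftOf? : ∀ r k → Dec (BlockPassesLeftOf r k)
    blockPassesLeftOf? r k = Any.any? (λ a → (lo a FP.≟ r) ×-dec passesLeftOf? a k) D

    blockPassesRightOf? : ∀ r k → Dec (BlockPassesRightOf r k)
    blockPassesRightOf? r k = Any.any? (λ a → (lo a FP.≟ r) ×-dec passesRightOf? a k) D

    blockEndsAt? : ∀ r k → Dec (BlockEndsAt r k)
    blockEndsAt? r k = (k FP.≟ r) ⊎-dec Any.any? (λ a → (lo a FP.≟ r) ×-dec (hi a FP.≟ k)) D

    leftOfBlock? : ∀ r r′ → Dec (LeftOfBlock r r′)
    leftOfBlock? r r′ = FP.any? λ k →
            (blockPassesLeftOf? r k ×-dec blockEndsAt? r′ k)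
      ⊎-dec (blockPassesLeftOf? r k ×-dec blockPassesRightOf? r′ k)
      ⊎-dec (blockEndsAt? r k ×-dec blockPassesRightOf? r′ k)

    top : Fin n → Fin n
    top r with hasArcAt? D r
    ... | yes has = hi (proj₁ (find has))
    ... | no _    = r

    starting-arc-unique : ∀ {r a b} → a ∈ D → lo a ≡ r → b ∈ D → lo b ≡ r → a ≡ b
    starting-arc-unique a∈ refl b∈ lo≡ = matching-lo-injective M a∈ b∈ (sym lo≡)

    top-arc : ∀ {a r} → a ∈ D → lo a ≡ r → top r ≡ hi a
    top-arc {a} {r} a∈ lo≡ with hasArcAt? D r
    ... | yes has = let (b , b∈ , lo-b) = find has in cong hi (starting-arc-unique b∈ lo-b a∈ lo≡)
    ... | no none = contradiction (lose a∈ lo≡) none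

    top-cases : ∀ r → (∃ λ a → a ∈ D × lo a ≡ r × top r ≡ hi a) ⊎ (¬ HasArcAt D r × top r ≡ r)
    top-cases r with hasArcAt? D r
    ... | yes has = let (a , a∈ , lo≡) = find has in inj₁ (a , a∈ , lo≡ , refl)
    ... | no none = inj₂ (none , refl)

    blockLeft⇒ : ∀ {r k a} → BlockPassesLeftOf r k → a ∈ D → lo a ≡ r → PassesLeftOf a k
    blockLeft⇒ {k = k} left a∈ lo≡ with find left
    ... | b , b∈ , lo-b , b-left = subst (λ c → PassesLeftOf c k) (starting-arc-unique b∈ lo-b a∈ lo≡) b-left

    blockRight⇒ : ∀ {r k a} → BlockPassesRightOf r k → a ∈ D → lo a ≡ r → PassesRightOf a k
    blockRight⇒ {k = k} right a∈ lo≡ with find right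
    ... | b , b∈ , lo-b , b-right = subst (λ c → PassesRightOf c k) (starting-arc-unique b∈ lo-b a∈ lo≡) b-right

    blockEnds⇒ : ∀ {r k a} → BlockEndsAt r k → a ∈ D → lo a ≡ r → EndsAt a k
    blockEnds⇒ (inj₁ k≡r) a∈ lo≡ = inj₁ (trans k≡r (sym lo≡))
    blockEnds⇒ (inj₂ ends) a∈ lo≡ with find ends
    ... | b , b∈ , lo-b , hi-b = inj₂ (trans (sym hi-b) (cong hi (starting-arc-unique b∈ lo-b a∈ lo≡)))

    lone-block-left : ∀ {r k} → ¬ HasArcAt D r → ¬ BlockPassesLeftOf r k
    lone-block-left none left = let (a , a∈ , lo≡ , _) = find left in none (lose a∈ lo≡)

    lone-block-right : ∀ {r k} → ¬ HasArcAt D r → ¬ BlockPassesRightOf r k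
    lone-block-right none right = let (a , a∈ , lo≡ , _) = find right in none (lose a∈ lo≡)

    lone-block-ends : ∀ {r k} → ¬ HasArcAt D r → BlockEndsAt r k → k ≡ r
    lone-block-ends none (inj₁ k≡r) = k≡r
    lone-block-ends none (inj₂ ends) = let (a , a∈ , lo≡ , _) = find ends in contradiction (lose a∈ lo≡) none

    blockLeft⇒¬blockRight : ∀ {r k} → BlockPassesLeftOf r k → ¬ BlockPassesRightOf r k
    blockLeft⇒¬blockRight left right with find left
    ... | a , a∈ , lo≡ , a-left = passesLeft⇒¬passesRight a _ a-left (blockRight⇒ right a∈ lo≡)

    blockLeftAt⇒ : ∀ {r r′ k a a′} → a ∈ D → lo a ≡ r → a′ ∈ D → lo a′ ≡ r′ →
                   BlockLeftAt r r′ k → StrictlyLeftAt a a′ k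
    blockLeftAt⇒ a∈ lo≡ a′∈ lo′≡ (inj₁ (l , e))        = inj₁ (blockLeft⇒ l a∈ lo≡ , blockEnds⇒ e a′∈ lo′≡)
    blockLeftAt⇒ a∈ lo≡ a′∈ lo′≡ (inj₂ (inj₁ (l , r))) = inj₂ (inj₁ (blockLeft⇒ l a∈ lo≡ , blockRight⇒ r a′∈ lo′≡))
    blockLeftAt⇒ a∈ lo≡ a′∈ lo′≡ (inj₂ (inj₂ (e , r))) = inj₂ (inj₂ (blockEnds⇒ e a∈ lo≡ , blockRight⇒ r a′∈ lo′≡))

    lo-head : ∀ {a} → a ∈ D → Head (lo a)
    lo-head {a} a∈ = proj₁ (S a∈) , λ is-top → let (b , b∈ , hi≡) = find is-top in not-top b b∈ hi≡
      where
      not-top : ∀ b → b ∈ D → hi b ≢ lo a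
      not-top b b∈ hi≡ with lo b FP.≟ lo a
      ... | yes lo≡ = FP.<⇒≢ (lo<hi b) (trans lo≡ (sym hi≡))
      ... | no lo≢  = proj₂ (proj₂ (proj₂ (matching-compatible M b∈ a∈ lo≢))) hi≡

    Spans : Fin n → Fin n → Set
    Spans r k = r F.≤ k × k F.≤ top r

    ≤top : ∀ r → r F.≤ top r
    ≤top r with top-cases r
    ... | inj₁ (a , _ , refl , top≡) = subst (lo a F.≤_) (sym top≡) (ℕP.<⇒≤ (lo<hi a))
    ... | inj₂ (_ , top≡)            = ℕP.≤-reflexive (cong toℕ (sym top≡))

    spans-left : ∀ {r k} → BlockPassesLeftOf r k → r F.< k × k F.< top r
    spans-left left with find left
    ... | a , a∈ , refl , (lo<k , k<hi , _) = lo<k , subst (_ F.<_) (sym (top-arc a∈ refl)) k<hi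

    spans-right : ∀ {r k} → BlockPassesRightOf r k → r F.< k × k F.< top r
    spans-right right with find right
    ... | a , a∈ , refl , (lo<k , k<hi , _) = lo<k , subst (_ F.<_) (sym (top-arc a∈ refl)) k<hi

    spans-ends : ∀ {r k} → BlockEndsAt r k → Spans r k
    spans-ends {r} (inj₁ refl) = ℕP.≤-refl , ≤top r
    spans-ends (inj₂ ends) with find ends
    ... | a , a∈ , refl , refl = ℕP.<⇒≤ (lo<hi a) , ℕP.≤-reflexive (cong toℕ (sym (top-arc a∈ refl)))

    spans : ∀ {r r′ k} → BlockLeftAt r r′ k → Spans r k × Spans r′ k
    spans (inj₁ (l , e)) = let (r<k , k<t) = spans-left l in (ℕP.<⇒≤ r<k , ℕP.<⇒≤ k<t) , spans-ends e
    spans (inj₂ (inj₁ (l , r))) =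
      let (r<k , k<t) = spans-left l ; (r′<k , k<t′) = spans-right r
      in (ℕP.<⇒≤ r<k , ℕP.<⇒≤ k<t) , (ℕP.<⇒≤ r′<k , ℕP.<⇒≤ k<t′)
    spans (inj₂ (inj₂ (e , r))) = let (r′<k , k<t′) = spans-right r in spans-ends e , (ℕP.<⇒≤ r′<k , ℕP.<⇒≤ k<t′)

    leftOfBlock-irrefl : ∀ {r} → ¬ LeftOfBlock r r
    leftOfBlock-irrefl (k , inj₁ (left , ends)) with find left
    ... | a , a∈ , lo≡ , a-left = passesLeft⇒¬endsAt a k a-left (blockEnds⇒ ends a∈ lo≡)
    leftOfBlock-irrefl (k , inj₂ (inj₁ (left , right))) = blockLeft⇒¬blockRight left right
    leftOfBlock-irrefl (k , inj₂ (inj₂ (ends , right))) with find right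
    ... | a , a∈ , lo≡ , a-right = passesRight⇒¬endsAt a k a-right (blockEnds⇒ ends a∈ lo≡)

    leftOfBlock-asym : ∀ {r r′} → LeftOfBlock r r′ → ¬ LeftOfBlock r′ r
    leftOfBlock-asym {r} {r′} (k , r<r′) (k′ , r′<r) with hasArcAt? D r | hasArcAt? D r′
    ... | yes has | yes has′ with find has | find has′
    ...   | a , a∈ , lo≡ | a′ , a′∈ , lo′≡ with lo a FP.≟ lo a′
    ...     | yes same = leftOfBlock-irrefl (k , subst (λ z → BlockLeftAt r z k)
              (trans (sym lo′≡) (trans (sym same) lo≡)) r<r′)
    ...     | no diff  = proj₁ (matching-compatible M a∈ a′∈ diff)
                           (k , k′ , blockLeftAt⇒ a∈ lo≡ a′∈ lo′≡ r<r′ , blockLeftAt⇒ a′∈ lo′≡ a∈ lo≡ r′<r)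
    leftOfBlock-asym {r} {r′} (k , r<r′) (k′ , r′<r) | no none | _ = lone r<r′ r′<r
      where
      lone : BlockLeftAt r r′ k → BlockLeftAt r′ r k′ → ⊥
      lone (inj₁ (l , _)) _ = lone-block-left none l
      lone (inj₂ (inj₁ (l , _))) _ = lone-block-left none l
      lone (inj₂ (inj₂ (e , right))) (inj₁ (l′ , e′)) =
        blockLeft⇒¬blockRight l′ (subst (BlockPassesRightOf r′)
          (trans (lone-block-ends none e) (sym (lone-block-ends none e′))) right)
      lone (inj₂ (inj₂ _)) (inj₂ (inj₁ (_ , right′))) = lone-block-right none right′
      lone (inj₂ (inj₂ _)) (inj₂ (inj₂ (_ , right′))) = lone-block-right none right′
    leftOfBlock-asym {r} {r′} (k , r<r′) (k′ , r′<r) | yes _ | no none′ = lone r<r′ r′<r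
      where
      lone : BlockLeftAt r r′ k → BlockLeftAt r′ r k′ → ⊥
      lone (inj₂ (inj₁ (_ , right))) _ = lone-block-right none′ right
      lone (inj₂ (inj₂ (_ , right))) _ = lone-block-right none′ right
      lone (inj₁ _) (inj₁ (l′ , _)) = lone-block-left none′ l′
      lone (inj₁ _) (inj₂ (inj₁ (l′ , _))) = lone-block-left none′ l′
      lone (inj₁ (l , e)) (inj₂ (inj₂ (e′ , right))) =
        blockLeft⇒¬blockRight l (subst (BlockPassesRightOf r)
          (trans (lone-block-ends none′ e′) (sym (lone-block-ends none′ e))) right)

    top≢head : ∀ {r z} → Head r → z ≢ r → top z ≢ r
    top≢head {r} {z} (_ , not-top) z≢r with top-cases z
    ... | inj₁ (a , a∈ , _ , top≡) = λ top≡r → not-top (lose a∈ (trans (sym top≡) top≡r))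
    ... | inj₂ (_ , top≡)          = λ top≡r → z≢r (trans (sym top≡) top≡r)

    top-injective : ∀ {r z} → Head r → Head z → top z ≡ top r → z ≡ r
    top-injective {r} {z} (_ , r-not-top) (_ , z-not-top) top≡ with top-cases z | top-cases r
    ... | inj₁ (a , a∈ , refl , tz) | inj₁ (b , b∈ , refl , tr) = same-top
      where
      same-top : lo a ≡ lo b
      same-top with lo a FP.≟ lo b
      ... | yes lo≡ = lo≡
      ... | no lo≢  = contradiction (trans (sym tz) (trans top≡ tr))
        (proj₁ (proj₂ (matching-compatible M a∈ b∈ lo≢)))
    ... | inj₁ (a , a∈ , _ , tz) | inj₂ (_ , tr) =
      contradiction (lose a∈ (trans (sym tz) (trans top≡ tr))) r-not-top
    ... | inj₂ (_ , tz) | inj₁ (b , b∈ , _ , tr) =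
      contradiction (lose b∈ (trans (sym tr) (trans (sym top≡) tz))) z-not-top
    ... | inj₂ (_ , tz) | inj₂ (_ , tr)          = trans (sym tz) (trans top≡ tr)

    ends-at-top : ∀ z → BlockEndsAt z (top z)
    ends-at-top z with top-cases z
    ... | inj₁ (a , a∈ , lo≡ , top≡) = inj₂ (lose a∈ (lo≡ , sym top≡))
    ... | inj₂ (_ , top≡)            = inj₁ top≡

    spanning : ∀ {r h} → r F.< h → h F.< top r → BlockPassesLeftOf r h ⊎ BlockPassesRightOf r h
    spanning {r} {h} r<h h<top with top-cases r
    ... | inj₂ (_ , top≡) = contradiction r<h (ℕP.<-asym (subst (h F.<_) top≡ h<top))
    ... | inj₁ (a , a∈ , refl , top≡) with bit a h BoolP.≟ true
    ...   | yes left = inj₁ (lose a∈ (refl , r<h , subst (h F.<_) top≡ h<top , left))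
    ...   | no ¬left = inj₂ (lose a∈ (refl , r<h , subst (h F.<_) top≡ h<top , BoolP.¬-not ¬left))

    -- If block z is lower than both r and c, then at height top z the block r passes left and c passes right.
    shortcut : ∀ {r z c} → Head r → Head z → Head c → LeftOfBlock r z → LeftOfBlock z c →
               top z F.≤ top r → top z F.≤ top c → LeftOfBlock r c
    shortcut {r} {z} {c} hr hz hc r<z@(k₁ , r<z-at) z<c@(k₂ , z<c-at) tz≤tr tz≤tc
      = top z , inj₂ (inj₁ (r-left , c-right))
      where
      z≢r : z ≢ r
      z≢r refl = leftOfBlock-irrefl r<z
      c≢z : c ≢ z
      c≢z refl = leftOfBlock-irrefl z<c
      r<top : r F.< top z
      r<top = let ((r≤k , _) , (_ , k≤t)) = spans r<z-at in
              ℕP.≤∧≢⇒< (ℕP.≤-trans r≤k k≤t) (λ e → top≢head hr z≢r (FP.toℕ-injective (sym e)))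
      c<top : c F.< top z
      c<top = let ((_ , k≤t) , (c≤k , _)) = spans z<c-at in
              ℕP.≤∧≢⇒< (ℕP.≤-trans c≤k k≤t) (λ e → top≢head hc (λ z≡c → c≢z (sym z≡c)) (FP.toℕ-injective (sym e)))
      top<r : top z F.< top r
      top<r = ℕP.≤∧≢⇒< tz≤tr (λ e → z≢r (top-injective hr hz (FP.toℕ-injective e)))
      top<c : top z F.< top c
      top<c = ℕP.≤∧≢⇒< tz≤tc (λ e → c≢z (sym (top-injective hc hz (FP.toℕ-injective e))))
      r-left : BlockPassesLeftOf r (top z)
      r-left with spanning r<top top<r
      ... | inj₁ left  = left
      ... | inj₂ right = contradiction (top z , inj₂ (inj₂ (ends-at-top z , right))) (leftOfBlock-asym r<z)
      c-right : BlockPassesRightOf c (top z)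
      c-right with spanning c<top top<c
      ... | inj₂ right = right
      ... | inj₁ left  = contradiction (top z , inj₁ (left , ends-at-top z)) (leftOfBlock-asym z<c)

    -- A block with no block to its right is a candidate.
    candidate-exists : ∀ {k} → k ∈ s → ∃ (Candidate D s)
    candidate-exists {k} k∈ =
      let (z , (z∈ , z-not-top) , z-rightmost) =
            sink-exists head? leftOfBlock? top (λ hz hc top≡ → top-injective hc hz top≡)
                        leftOfBlock-irrefl shortcut some-head
      in z , candidate z∈ z-not-top (passed-on-left z-rightmost) (nothing-left z-rightmost)
      where
      some-head : ∃ Head
      some-head with isTop? D k
      ... | no not-top = k , k∈ , not-top
      ... | yes is-top = let (a , a∈ , _) = find is-top in lo a , lo-head a∈
      module _ {z} (rightmost : ∀ c → Head c → ¬ LeftOfBlock z c) where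
        passed-on-left : ∀ {a} → a ∈ D → lo a F.< z → z F.< hi a → bit a z ≡ true
        passed-on-left {a} a∈ lo<z z<hi = BoolP.¬-not λ right →
          rightmost (lo a) (lo-head a∈) (z , inj₂ (inj₂ (inj₁ refl , lose a∈ (refl , lo<z , z<hi , right))))
        nothing-left : ∀ {a} → a ∈ D → lo a ≡ z → ∀ k → bit a k ≡ false
        nothing-left {a} a∈ lo≡z k = BoolP.¬-not λ left →
          let (lo<k , k<hi) = bit⇒between a left
              z-left : BlockPassesLeftOf z k
              z-left = lose a∈ (lo≡z , lo<k , k<hi , left)
          in block-at k z-left (proj₂ (proj₂ (S a∈)) k left)
          where
          block-at : ∀ k → BlockPassesLeftOf z k → k ∈ s → ⊥
          block-at k z-left k∈s with isTop? D k
          ... | no not-top = rightmost k (k∈s , not-top) (k , inj₁ (z-left , inj₁ refl))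
          ... | yes is-top = let (b , b∈ , hi≡) = find is-top in
                             rightmost (lo b) (lo-head b∈) (k , inj₁ (z-left , inj₂ (lose b∈ (refl , hi≡))))

module Reconstruction (n : ℕ) where
  open Arcs n
  open DescentArcs n
  open Candidates n
  open CandidateExists n
  open Positions (FP._≟_ {n})

  module Removal (D : List (Arc n)) (s : Word) (M : IsMatching D) (S : Supported D s) (us : Unique s)
                 (v : Fin n) (cv : Candidate D s v) where
    open Candidate cv

    s′ : Word
    s′ = remove v s
    D′ : List (Arc n)
    D′ = deletePoint v D

    hi≢v : ∀ {a} → a ∈ D → hi a ≢ v
    hi≢v a∈ hi≡v = not-top (lose a∈ hi≡v)

    D′-matching : IsMatching D′
    D′-matching = deletePoint-matching v M hi≢v

    D′-supported : Supported D′ s′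
    D′-supported a′∈ with ∈-deletePoint⁻ v D a′∈
    ... | a , a∈ , lo≢v , refl =
      let (lo∈ , hi∈ , left∈) = S a∈ in
      ∈-remove⁺ v s lo∈ lo≢v , ∈-remove⁺ v s hi∈ (hi≢v a∈) ,
      λ k left → ∈-remove⁺ v s (left∈ k (trans (sym (bit-clear v a (k≢v k left))) left)) (k≢v k left)
      where
      k≢v : ∀ k → bit (clear v a) k ≡ true → k ≢ v
      k≢v k left refl = contradiction (trans (sym left) (bit-clear-self v a)) λ ()

    candidate-lift : ∀ {u} → Candidate D′ s′ u → v F.< u →
      (∀ {b} → b ∈ D → lo b ≡ v → hi b F.< u) → Candidate D s u
    candidate-lift {u} (candidate u∈ u-not-top u-left u-nothing-left) v<u below-u =
      candidate (proj₁ (∈-remove⁻ v s us u∈)) not-top′ left′ nothing-left′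
      where
      not-top′ : ¬ IsTop D u
      not-top′ is-top with find is-top
      ... | a , a∈ , hi≡u with lo a FP.≟ v
      ...   | yes lo≡v = FP.<⇒≢ (below-u a∈ lo≡v) hi≡u
      ...   | no lo≢v  = u-not-top (lose (∈-deletePoint⁺ v D a∈ lo≢v) hi≡u)
      left′ : ∀ {a} → a ∈ D → lo a F.< u → u F.< hi a → bit a u ≡ true
      left′ {a} a∈ lo<u u<hi with lo a FP.≟ v
      ... | yes lo≡v = contradiction (below-u a∈ lo≡v) (FP.<-asym u<hi)
      ... | no lo≢v  = trans (sym (bit-clear v a (λ { refl → FP.<⇒≢ v<u refl })))
        (u-left (∈-deletePoint⁺ v D a∈ lo≢v) lo<u u<hi)
      nothing-left′ : ∀ {a} → a ∈ D → lo a ≡ u → ∀ k → bit a k ≡ false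
      nothing-left′ {a} a∈ lo≡u k with lo a FP.≟ v
      ... | yes lo≡v = contradiction (trans (sym lo≡v) lo≡u) (FP.<⇒≢ v<u)
      ... | no lo≢v with k FP.≟ v
      ...   | yes refl = BoolP.¬-not λ left → FP.<-asym (proj₁ (bit⇒between a left))
          (subst (k F.<_) (sym lo≡u) v<u)
      ...   | no k≢v   = trans (sym (bit-clear v a k≢v)) (u-nothing-left (∈-deletePoint⁺ v D a∈ lo≢v) lo≡u k)

    top-candidate : ∀ {b} → b ∈ D → lo b ≡ v → Candidate D′ s′ (hi b)
    top-candidate {b} b∈ lo≡v = candidate (∈-remove⁺ v s (proj₁ (proj₂ (S b∈))) (hi≢v b∈))
      not-top′ left′ nothing-left′
      where
      compatible : ∀ {a} → a ∈ D → lo a ≢ v → Compatible a b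
      compatible a∈ lo≢v = matching-compatible M a∈ b∈ (λ lo≡ → lo≢v (trans lo≡ lo≡v))
      not-top′ : ¬ IsTop D′ (hi b)
      not-top′ is-top with find is-top
      ... | a′ , a′∈ , hi≡ with ∈-deletePoint⁻ v D a′∈
      ...   | a , a∈ , lo≢v , refl = proj₁ (proj₂ (compatible a∈ lo≢v)) hi≡
      left′ : ∀ {a′} → a′ ∈ D′ → lo a′ F.< hi b → hi b F.< hi a′ → bit a′ (hi b) ≡ true
      left′ a′∈ lo<hb hb<hi with ∈-deletePoint⁻ v D a′∈
      ... | a , a∈ , lo≢v , refl =
        trans (bit-clear v a (hi≢v b∈)) (BoolP.¬-not λ right →
          proj₁ (compatible a∈ lo≢v) (crossing a a∈ lo≢v lo<hb hb<hi
            (inj₂ (inj₂ (inj₂ refl , (lo<hb , hb<hi , right))))))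
        where
        -- a passes right of the top of b; below, a passes left of v or b passes right of lo a.
        crossing : ∀ a → a ∈ D → lo a ≢ v → lo a F.< hi b → hi b F.< hi a → StrictlyLeftAt b a (hi b) → Cross a b
        crossing a a∈ lo≢v lo<hb hb<hi b<a with FP.<-cmp (lo a) v
        ... | tri< lo<v _ _ =
          let v<hi = FP.<-trans (subst (F._< hi b) lo≡v (lo<hi b)) hb<hi
          in v , hi b , inj₁ ((lo<v , v<hi , passed-on-left a∈ lo<v v<hi) , inj₁ (sym lo≡v)) , b<a
        ... | tri≈ _ lo≡v′ _ = contradiction lo≡v′ lo≢v
        ... | tri> _ _ v<lo =
          lo a , hi b , inj₂ (inj₂ (inj₁ refl ,
            (subst (F._< lo a) (sym lo≡v) v<lo , lo<hb , nothing-left b∈ lo≡v (lo a))))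
          , b<a
      nothing-left′ : ∀ {a′} → a′ ∈ D′ → lo a′ ≡ hi b → ∀ k → bit a′ k ≡ false
      nothing-left′ a′∈ lo≡ k with ∈-deletePoint⁻ v D a′∈
      ... | a , a∈ , lo≢v , refl = contradiction lo≡ (proj₁ (proj₂ (proj₂ (compatible a∈ lo≢v))))

  record Arrangement (s x : Word) : Set where
    constructor arrangement
    field
      unique  : Unique x
      x⊆s     : ∀ {k} → k ∈ x → k ∈ s
      s⊆x     : ∀ {k} → k ∈ s → k ∈ x
      length≡ : length x ≡ length s

  module Extension (D : List (Arc n)) (s : Word) (M : IsMatching D) (S : Supported D s) (us : Unique s)
                   (v : Fin n) (cv : Candidate D s v) (v-max : ∀ {u} → Candidate D s u → u F.≤ v)
                   (x′ : Word) (ax′ : Arrangement (remove v s) x′) (no321′ : NoConsecutive321 x′)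
                   (δx′ : δ x′ ≡ deletePoint v D) where
    open Removal D s M S us v cv
    open Candidate cv
    open Arrangement ax′ renaming (unique to ux′; x⊆s to x′⊆s′; s⊆x to s′⊆x′; length≡ to length-x′)

    x : Word
    x = x′ ∷ʳ v
    v∉x′ : v ∉ x′
    v∉x′ v∈ = proj₂ (∈-remove⁻ v s us (x′⊆s′ v∈)) refl
    ux : Unique x
    ux = ∷ʳ⁺-unique x′ v ux′ v∉x′

    last-candidate : ∀ y w → x′ ≡ y ∷ʳ w → Candidate D′ s′ w × (∀ {u} → Candidate D′ s′ u → u F.≤ w)
    last-candidate y w refl =
      subst (λ E → Candidate E s′ w) δx′ (last-letter-candidate (x′⊆s′ (∈-∷ʳ-last y w))) ,
      λ cu → last-letter-maximal s′⊆x′ (subst (λ E → Candidate E s′ _) (sym δx′) cu)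
      where open LastLetter y w ux′

    last-is-top : ∀ {b} → b ∈ D → lo b ≡ v → ∃ λ y → x′ ≡ y ∷ʳ hi b
    last-is-top {b} b∈ lo≡v with L.initLast x′ | s′⊆x′ (Candidate.in-support (top-candidate b∈ lo≡v))
    ... | L.[] | ()
    ... | y L.∷ʳ′ w | _ = y , cong (y ∷ʳ_) w≡hi
      where
      v<hi : v F.< hi b
      v<hi = subst (F._< hi b) lo≡v (lo<hi b)
      w≡hi : w ≡ hi b
      w≡hi with last-candidate y w refl
      ... | cw , w-max = FP.≤-antisym (ℕP.≮⇒≥ λ hi<w → ℕP.<⇒≱ (FP.<-trans v<hi hi<w)
                           (v-max (candidate-lift cw (FP.<-trans v<hi hi<w)
                             λ b′∈ lo′≡v → subst (λ c → hi c F.< w)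
                                (matching-lo-injective M b∈ b′∈ (trans lo≡v (sym lo′≡v))) hi<w)))
                         (w-max (top-candidate b∈ lo≡v))

    last-below : ¬ HasArcAt D v → ∀ y w → x′ ≡ y ∷ʳ w → w F.< v
    last-below no-arc y w x′≡ =
      ℕP.≤∧≢⇒< (ℕP.≮⇒≥ λ v<w → ℕP.<⇒≱ v<w (v-max (candidate-lift (proj₁ (last-candidate y w x′≡)) v<w
                                                   λ b∈ lo≡v → contradiction (lose b∈ lo≡v) no-arc)))
               (λ w≡v → v∉x′ (subst (_∈ x′) (FP.toℕ-injective w≡v) (subst (w ∈_) (sym x′≡) (∈-∷ʳ-last y w))))

    arrangement-x : Arrangement s x
    arrangement-x = arrangement ux x⊆s s⊆x
      (trans (length-∷ʳ x′ v) (trans (cong suc length-x′) (length-remove v s (in-support))))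
      where
      x⊆s : ∀ {k} → k ∈ x → k ∈ s
      x⊆s k∈ = [ (λ k∈x′ → proj₁ (∈-remove⁻ v s us (x′⊆s′ k∈x′))) , (λ { refl → in-support }) ]′ (∈-∷ʳ⁻ x′ k∈)
      s⊆x : ∀ {k} → k ∈ s → k ∈ x
      s⊆x {k} k∈ with k FP.≟ v
      ... | yes refl = ∈-∷ʳ-last x′ v
      ... | no k≢v   = ∈-++⁺ˡ (s′⊆x′ (∈-remove⁺ v s k∈ k≢v))

    descentArc-restored : ∀ {c p q} .(p<q : p F.< q) → c ∈ D → clear v c ≡ descentArc x′ p q p<q → p ∈ x′ →
                          descentArc x p q p<q ≡ c
    descentArc-restored {c} {p} {q} p<q c∈ clear≡ p∈ = arc-≡ _ c (sym (cong lo clear≡)) (sym (cong hi clear≡)) bits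
      where
      bits : ∀ k → lookup (leftSet x p q) k ≡ bit c k
      bits k with k FP.≟ v
      ... | no k≢v = trans (leftOf-∷ʳ x′ v v∉x′ {q = q} p∈ k≢v)
        (trans (sym (cong (λ a → bit a k) clear≡)) (bit-clear v c k≢v))
      ... | yes refl with p FP.<? k | k FP.<? q
      ...   | yes p<k | yes k<q = trans (leftOf-∷ʳ-last x′ k v∉x′ p∈ p<k k<q)
                                      (sym (passed-on-left c∈ (subst (F._< k) (sym (cong lo clear≡)) p<k)
                                                               (subst (k F.<_) (sym (cong hi clear≡)) k<q)))
      ...   | no p≮k | _ = trans (BoolP.¬-not λ left → p≮k (proj₁ (leftSet-true⇒ x p q left)))
                                 (sym (BoolP.¬-not λ left → p≮k (subst (F._< k) (cong lo clear≡)
                    (proj₁ (bit⇒between c left)))))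
      ...   | yes _ | no k≮q = trans (BoolP.¬-not λ left → k≮q (proj₁ (proj₂ (leftSet-true⇒ x p q left))))
                                 (sym (BoolP.¬-not λ left → k≮q (subst (k F.<_) (cong hi clear≡)
                    (proj₂ (bit⇒between c left)))))

    descentArc-last : ∀ {b} .(v<hi : v F.< hi b) → b ∈ D → lo b ≡ v → descentArc x v (hi b) v<hi ≡ b
    descentArc-last {b} v<hi b∈ lo≡v = arc-≡ _ b (sym lo≡v) refl λ k →
      trans (nothing-left-of-last x′ v v∉x′ (hi b) k) (sym (nothing-left b∈ lo≡v k))

    before-v : ∀ {j w} → suc j ≡ length x′ → entry x′ j ≡ just w →
               (∃ λ b → b ∈ D × lo b ≡ v × w ≡ hi b) ⊎ (¬ HasArcAt D v × w F.< v)
    before-v len w-at with entry⇒∷ʳ x′ len w-at | hasArcAt? D v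
    ... | y , x′≡ | yes has = let (b , b∈ , lo≡v) = find has ; (y′ , x′≡′) = last-is-top b∈ lo≡v in
                              inj₁ (b , b∈ , lo≡v , ListP.∷ʳ-injectiveʳ y y′ (trans (sym x′≡) x′≡′))
    ... | y , x′≡ | no none = inj₂ (none , last-below none y _ x′≡)

    length-x : length x ≡ suc (length x′)
    length-x = length-∷ʳ x′ v

    below-L : ∀ {i k} → entry x i ≡ just k → i ≤ length x′
    below-L e = ℕP.≤-pred (subst (_ ℕ.<_) length-x (entry⇒< x e))

    down : ∀ {i k} → i ℕ.< length x′ → entry x i ≡ just k → entry x′ i ≡ just k
    down i< e = trans (sym (entry-∷ʳ x′ v i<)) e

    arc-in-D′ : (d : Descent x′) → arcOf d ∈ D′
    arc-in-D′ d = subst (arcOf d ∈_) δx′ (∈-δ⁺ ux′ d)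

    i+1<L : ∀ {i} → suc (suc i) ≡ length x′ → suc i ℕ.< length x′
    i+1<L i+2≡L = subst (_ ℕ.<_) i+2≡L ℕP.≤-refl

    321-ending-at-v : ∀ i {a b c} → suc (suc i) ≡ length x′ → entry x i ≡ just a → entry x (suc i) ≡ just b →
                      entry x (suc (suc i)) ≡ just c → b F.< a → ¬ c F.< b
    321-ending-at-v i i+2≡L a-at b-at c-at b<a c<b with before-v i+2≡L (down (i+1<L i+2≡L) b-at)
    ... | inj₂ (_ , b<v) =
      FP.<-asym b<v (subst (F._< _) (entry-functional x c-at
        (subst (λ j → entry x j ≡ just v) (sym i+2≡L) (entry-∷ʳ-last x′ v)))
        c<b)
    ... | inj₁ (b₀ , b₀∈ , lo≡v , b≡hi)
      with ∈-deletePoint⁻ v D (arc-in-D′ (descent i (down (ℕP.<-trans (ℕP.n<1+n i) (i+1<L i+2≡L)) a-at)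
                                                                    (down (i+1<L i+2≡L) b-at) b<a))
    ...   | c₀ , c₀∈ , lo≢v , clear≡ =
      proj₁ (proj₂ (proj₂ (matching-compatible M c₀∈ b₀∈ (λ lo≡ → lo≢v (trans lo≡ lo≡v)))))
        (trans (cong lo (sym clear≡)) b≡hi)

    no321-x : NoConsecutive321 x
    no321-x i a-at b-at c-at b<a c<b with suc (suc i) ℕP.<? length x′
    ... | yes i+2< = no321′ i (down (ℕP.<-trans (ℕP.n<1+n i) (ℕP.<-trans (ℕP.n<1+n (suc i)) i+2<)) a-at)
                              (down (ℕP.<-trans (ℕP.n<1+n (suc i)) i+2<) b-at) (down i+2< c-at) b<a c<b
    ... | no ¬i+2< = 321-ending-at-v i (ℕP.≤-antisym (below-L c-at) (ℕP.≮⇒≥ ¬i+2<)) a-at b-at c-at b<a c<b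

    δ-x : δ x ≡ D
    δ-x = sorted-arcs-ext (δ-sorted x) (matching-sorted M) to from
      where
      to : ∀ {a} → a ∈ δ x → a ∈ D
      to a∈ with ∈-δ⁻ x a∈
      ... | d@(descent i {q} {p} q-at p-at p<q) , refl with p FP.≟ v
      ...   | no p≢v with descent-∷ʳ⁻ x′ v v∉x′ d p≢v
      ...     | d′@(descent _ _ p-at′ _) , refl , refl with ∈-deletePoint⁻ v D (arc-in-D′ d′)
      ...       | c , c∈ , _ , clear≡ = subst (_∈ D)
          (sym (descentArc-restored p<q c∈ (sym clear≡) (entry⇒∈ x′ p-at′))) c∈
      to a∈ | d@(descent i {q} {p} q-at p-at p<q) , refl | yes refl
          with before-v i+1≡L (down (subst (i ℕ.<_) i+1≡L ℕP.≤-refl) q-at)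
        where
        i+1≡L : suc i ≡ length x′
        i+1≡L = entry-injective x ux p-at (entry-∷ʳ-last x′ p)
      ...   | inj₁ (b , b∈ , lo≡v , refl) = subst (_∈ D) (sym (descentArc-last p<q b∈ lo≡v)) b∈
      ...   | inj₂ (_ , q<v) = contradiction p<q (FP.<-asym q<v)
      from : ∀ {c} → c ∈ D → c ∈ δ x
      from {c} c∈ with lo c FP.≟ v
      ... | no lo≢v with ∈-δ⁻ x′ (subst (clear v c ∈_) (sym δx′) (∈-deletePoint⁺ v D c∈ lo≢v))
      ...   | d′@(descent _ {q} {p} _ p-at p<q) , clear≡ =
        subst (_∈ δ x) (descentArc-restored p<q c∈ clear≡ (entry⇒∈ x′ p-at)) (∈-δ⁺ ux (descent-∷ʳ⁺ x′ v v∉x′ d′))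
      from {c} c∈ | yes lo≡v with last-is-top c∈ lo≡v
      ... | y , refl = subst (_∈ δ x) (descentArc-last v<hi c∈ lo≡v) (∈-δ⁺ ux (descent (length y) hi-at v-at v<hi))
        where
        v<hi : v F.< hi c
        v<hi = subst (F._< hi c) lo≡v (lo<hi c)
        hi-at : entry x (length y) ≡ just (hi c)
        hi-at = entry-∷ʳ⁺ (y ∷ʳ hi c) v (entry-∷ʳ-last y (hi c))
        v-at : entry x (suc (length y)) ≡ just v
        v-at = subst (λ j → entry x j ≡ just v) (length-∷ʳ y (hi c)) (entry-∷ʳ-last (y ∷ʳ hi c) v)

  reconstruct : ∀ s → Acc ℕ._<_ (length s) → Unique s → ∀ D → IsMatching D → Supported D s →
                ∃ λ x → Arrangement s x × NoConsecutive321 x × δ x ≡ D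
  reconstruct [] _ _ D M S =
    [] , arrangement [] (λ ()) (λ ()) refl , (λ _ ()) ,
    sorted-arcs-ext (δ-sorted []) (matching-sorted M) (λ a∈ → no-descent (proj₁ (∈-δ⁻ [] a∈)))
                    (λ a∈ → contradiction (proj₁ (S a∈)) λ ())
    where
    no-descent : ∀ {A : Set} → Descent [] → A
    no-descent (descent _ () _ _)
  reconstruct s@(_ ∷ _) (acc smaller) us D M S =
    let (v , cv , v-max) = max-satisfying (candidate? D s) (Blocks.candidate-exists D s M S (here refl))
        open Removal D s M S us v cv
        (x′ , ax′ , no321′ , δx′) = reconstruct s′
            (smaller (ℕP.≤-reflexive (length-remove v s (Candidate.in-support cv))))
                                                (remove-unique v s us) D′ D′-matching D′-supported
        open Extension D s M S us v cv (λ {u} → v-max u) x′ ax′ no321′ δx′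
    in x , arrangement-x , no321-x , δ-x

  arrangement-∷ʳ⁻ : ∀ {s} x′ v → Unique s → Arrangement s (x′ ∷ʳ v) → Arrangement (remove v s) x′
  arrangement-∷ʳ⁻ {s} x′ v us (arrangement ux x⊆s s⊆x len) =
    arrangement ux′ (λ k∈ → ∈-remove⁺ v s (x⊆s (∈-++⁺ˡ k∈)) λ { refl → v∉x′ k∈ }) s′⊆x′
      (ℕP.suc-injective (trans (sym (length-∷ʳ x′ v))
        (trans len (sym (length-remove v s (x⊆s (∈-∷ʳ-last x′ v)))))))
    where
    ux′ : Unique x′
    ux′ = proj₁ (∷ʳ⁻-unique x′ v ux)
    v∉x′ : v ∉ x′
    v∉x′ = proj₂ (∷ʳ⁻-unique x′ v ux)
    s′⊆x′ : ∀ {k} → k ∈ remove v s → k ∈ x′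
    s′⊆x′ k∈ with ∈-remove⁻ v s us k∈
    ... | k∈s , k≢v = [ (λ k∈x′ → k∈x′) , (λ k≡v → contradiction k≡v k≢v) ]′ (∈-∷ʳ⁻ x′ (s⊆x k∈s))

  -- Both last letters are the largest candidate of the common diagram.
  same-last-letter : ∀ {s} x′ v y′ w → Arrangement s (x′ ∷ʳ v) → Arrangement s (y′ ∷ʳ w) →
                     δ (x′ ∷ʳ v) ≡ δ (y′ ∷ʳ w) → v ≡ w
  same-last-letter {s} x′ v y′ w ax ay δ≡ =
    FP.≤-antisym (Y.last-letter-maximal (Arrangement.s⊆x ay)
                  (subst (λ E → Candidate E s v) δ≡ (X.last-letter-candidate v∈s)))
                 (X.last-letter-maximal (Arrangement.s⊆x ax)
                  (subst (λ E → Candidate E s w) (sym δ≡) (Y.last-letter-candidate w∈s)))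
    where
    module X = LastLetter x′ v (Arrangement.unique ax)
    module Y = LastLetter y′ w (Arrangement.unique ay)
    v∈s : v ∈ s
    v∈s = Arrangement.x⊆s ax (∈-∷ʳ-last x′ v)
    w∈s : w ∈ s
    w∈s = Arrangement.x⊆s ay (∈-∷ʳ-last y′ w)

  δ-injective : ∀ {s} x y → Acc ℕ._<_ (length x) → Unique s → Arrangement s x → Arrangement s y →
                NoConsecutive321 x → NoConsecutive321 y → δ x ≡ δ y → x ≡ y
  δ-injective x y rec us ax ay no321x no321y δ≡ with L.initLast x | L.initLast y
  ... | L.[] | L.[] = refl
  ... | L.[] | y′ L.∷ʳ′ w with () ← Arrangement.s⊆x ax (Arrangement.x⊆s ay (∈-∷ʳ-last y′ w))
  ... | x′ L.∷ʳ′ v | L.[] with () ← Arrangement.s⊆x ay (Arrangement.x⊆s ax (∈-∷ʳ-last x′ v))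
  ... | x′ L.∷ʳ′ v | y′ L.∷ʳ′ w with same-last-letter x′ v y′ w ax ay δ≡
  ...   | refl with rec
  ...     | acc smaller = cong (_∷ʳ v) (δ-injective x′ y′ (smaller (ℕP.≤-reflexive (sym (length-∷ʳ x′ v))))
                            (remove-unique v _ us) (arrangement-∷ʳ⁻ x′ v us ax) (arrangement-∷ʳ⁻ y′ v us ay)
                            (no321-∷ʳ⁻ x′ v no321x) (no321-∷ʳ⁻ y′ v no321y)
                            (trans (δ-∷ʳ x′ v (Arrangement.unique ax)) (trans (cong (deletePoint v) δ≡)
                                   (sym (δ-∷ʳ y′ v (Arrangement.unique ay))))))

module Bijection (n : ℕ) where
  open Arcs n
  open DescentArcs n
  open Reconstruction n
  open Positions (FP._≟_ {n})

  permutation⇒unique : (x : Vec (Fin n) n) → IsPermutation x → Unique (V.toList x)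
  permutation⇒unique x perm = injective-entry⇒unique (V.toList x) λ {i} {j} ei ej →
    let (i′ , i′≡i , at-i) = entry-toList⁻ x i ei
        (j′ , j′≡j , at-j) = entry-toList⁻ x j ej
    in trans (sym i′≡i) (trans (cong toℕ (perm i′ j′ (trans at-i (sym at-j)))) j′≡j)

  avoids321⇒no321 : (x : Vec (Fin n) n) → Avoids321 x → NoConsecutive321 (V.toList x)
  avoids321⇒no321 x avoids i ea eb ec b<a c<b =
    let (i₁ , i₁≡ , at₁) = entry-toList⁻ x i ea
        (i₂ , i₂≡ , at₂) = entry-toList⁻ x (suc i) eb
        (i₃ , i₃≡ , at₃) = entry-toList⁻ x (suc (suc i)) ec
    in avoids i₁ i₂ i₃ (trans i₂≡ (cong suc (sym i₁≡))) (trans i₃≡ (cong suc (sym i₂≡)))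
         (subst₂ F._<_ (sym at₂) (sym at₁) b<a , subst₂ F._<_ (sym at₃) (sym at₂) c<b)

  permutation⇒arrangement : (x : Vec (Fin n) n) → IsPermutation x → Arrangement (allFin n) (V.toList x)
  permutation⇒arrangement x perm =
    arrangement (permutation⇒unique x perm) (λ _ → ∈-allFin _) covers
                (trans (VecP.length-toList x) (sym (ListP.length-tabulate (λ i → i))))
    where
    covers : ∀ {k} → k ∈ allFin n → k ∈ V.toList x
    covers {k} _ = let (i , xi≡k) = injective⇒surjective (lookup x) perm k in
                   entry⇒∈ (V.toList x) (trans (entry-toList x i) (cong just xi≡k))

  permutation-avoiding321? : (x : Vec (Fin n) n) → Dec (IsPermutation x × Avoids321 x)
  permutation-avoiding321? x =
    FP.all? (λ i → FP.all? λ j → (lookup x i FP.≟ lookup x j) →-dec (i FP.≟ j)) ×-dec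
    FP.all? (λ i → FP.all? λ j → FP.all? λ k → (toℕ j ℕP.≟ suc (toℕ i)) →-dec ((toℕ k ℕP.≟ suc (toℕ j)) →-dec
      ¬? ((lookup x j FP.<? lookup x i) ×-dec (lookup x k FP.<? lookup x j))))

  Perm : Set
  Perm = Consecutive321Avoiding n
  Matching : Set
  Matching = NoncrossingMatching n

  properties : (π : Perm) → IsPermutation (value π) × Avoids321 (value π)
  properties π = fromIrrelevant (permutation-avoiding321? (value π)) (proof π)

  toMatching : Perm → Matching
  toMatching π = record
    { value = δ (V.toList (value π))
    ; proof = Irrelevant.map (λ (perm , avoids) → δ-matching (permutation⇒unique (value π) perm)
                                                             (avoids321⇒no321 (value π) avoids)) (proof π) }

  toMatching-injective : ∀ {π₁ π₂} → toMatching π₁ ≡ toMatching π₂ → π₁ ≡ π₂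
  toMatching-injective {π₁} {π₂} e =
    let (perm₁ , avoids₁) = properties π₁
        (perm₂ , avoids₂) = properties π₂
        x₁ = value π₁ ; x₂ = value π₂
    in value-injective (trans (sym (VecP.cast-is-id refl x₁)) (VecP.toList-injective refl x₁ x₂
         (δ-injective (V.toList x₁) (V.toList x₂) (<-wellFounded _) (UniqueP.allFin⁺ n)
            (permutation⇒arrangement x₁ perm₁) (permutation⇒arrangement x₂ perm₂)
            (avoids321⇒no321 x₁ avoids₁) (avoids321⇒no321 x₂ avoids₂) (cong value e))))

  toMatching-surjective : ∀ D → ∃ λ π → ∀ {π′} → π′ ≡ π → toMatching π′ ≡ D
  toMatching-surjective D
    with reconstruct (allFin n) (<-wellFounded _) (UniqueP.allFin⁺ n) (value D)
                     (fromIrrelevant (isMatching? (value D)) (proof D))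
                     (λ _ → ∈-allFin _ , ∈-allFin _ , λ _ _ → ∈-allFin _)
  ... | x , ax , no321 , δx = π , λ { refl → value-injective (trans (cong δ toList-x) δx) }
    where
    length-x : length x ≡ n
    length-x = trans (Arrangement.length≡ ax) (ListP.length-tabulate (λ i → i))
    vx : Vec (Fin n) n
    vx = V.cast length-x (V.fromList x)
    toList-x : V.toList vx ≡ x
    toList-x = trans (VecP.toList-cast length-x (V.fromList x)) (VecP.toList∘fromList x)
    entry-vx : ∀ i → entry x (toℕ i) ≡ just (lookup vx i)
    entry-vx i = subst (λ l → entry l (toℕ i) ≡ just (lookup vx i)) toList-x (entry-toList vx i)
    perm : IsPermutation vx
    perm i j e = FP.toℕ-injective (entry-injective x (Arrangement.unique ax) (entry-vx i)
                                     (subst (λ z → entry x (toℕ j) ≡ just z) (sym e) (entry-vx j)))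
    avoids : Avoids321 vx
    avoids i j k j≡ k≡ (b<a , c<b) =
      no321 (toℕ i) (entry-vx i) (subst (λ z → entry x z ≡ just (lookup vx j)) j≡ (entry-vx j))
        (subst (λ z → entry x z ≡ just (lookup vx k)) (trans k≡ (cong suc j≡)) (entry-vx k)) b<a c<b
    π : Perm
    π = record { value = vx ; proof = [ (perm , avoids) ] }

  bijection : Perm ⤖ Matching
  bijection = mk⤖ ((λ {π₁} {π₂} → toMatching-injective {π₁} {π₂}) , toMatching-surjective)

theorem3p8 : (n : ℕ) → 1 ≤ n → NoncrossingMatching n ⤖ Consecutive321Avoiding n
theorem3p8 n _ = BijectionP.sym-≡ (Bijection.bijection n)
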